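{- Let $G$ be an $n$-vertex graph given as a stream in the Adjacency List (AL) model, and suppose a vertex cover $X$ of $G$ with $|X| = k$ is given. Then \textsc{Diameter} and \textsc{Connectivity} on $G$ can each be solved by a streaming algorithm using $O(2^k k)$ passes and $O(k \log n)$ bits of memory, and can also each be solved by a streaming algorithm using one pass and $O(2^k + k\log n)$ bits of memory.
   Context: Graphs are finite, simple, undirected and unweighted. A vertex cover of $G$ is a set $X \subseteq V(G)$ containing at least one endpoint of every edge. \textsc{Diameter} asks to compute $\max_{s,t \in V(G)} d(s,t)$, where $d(s,t)$ is the shortest-path distance ($+\infty$ if $s,t$ lie in different components); \textsc{Connectivity} asks whether $G$ is connected. In the Adjacency List (AL) streaming model the graph is presented as a sequence of vertices in an arbitrary but fixed order, each vertex appearing together with the complete list of its incident edges (so every edge appears twice, once at each endpoint). A $p$-pass streaming algorithm reads this same sequence $p$ times, has unlimited computation time, and its memory is the number of bits it stores. -}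

module Defs where

open import Data.Bool using (Bool; true; false)
open import Data.Nat using (ℕ; zero; suc; _≤_)
open import Data.Fin using (Fin)
open import Data.Fin.Subset using (Subset; _∈_; ∣_∣)
open import Data.List using (List; []; _∷_; map; concatMap; foldl; filterᵇ; allFin)
open import Data.List.Relation.Binary.Permutation.Propositional using (_↭_)
open import Data.Vec using (Vec)
open import Data.Maybe using (Maybe; just; nothing)
open import Data.Product using (Σ; ∃; _×_)
open import Data.Sum using (_⊎_)
open import Relation.Nullary using (¬_)
open import Relation.Binary.PropositionalEquality using (_≡_)

record Graph (n : ℕ) : Set where
  field
    adj    : Fin n → Fin n → Bool
    sym    : ∀ u v → adj u v ≡ adj v u
    irrefl : ∀ v → adj v v ≡ false
open Graph public

nbrs : ∀ {n} → Graph n → Fin n → List (Fin n)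
nbrs G v = filterᵇ (adj G v) (allFin _)

IsVertexCover : ∀ {n} → Graph n → Subset n → Set
IsVertexCover G X = ∀ u v → adj G u v ≡ true → (u ∈ X) ⊎ (v ∈ X)

data Walk {n} (G : Graph n) : Fin n → Fin n → ℕ → Set where
  here : ∀ {s} → Walk G s s 0
  step : ∀ {s u t ℓ} → adj G s u ≡ true → Walk G u t ℓ → Walk G s t (suc ℓ)

IsDist : ∀ {n} → Graph n → Fin n → Fin n → ℕ → Set
IsDist G s t d = Walk G s t d × (∀ ℓ → Walk G s t ℓ → d ≤ ℓ)

Reachable : ∀ {n} → Graph n → Fin n → Fin n → Set
Reachable G s t = ∃ λ ℓ → Walk G s t ℓ

-- diameter value: nothing encodes +∞
IsDiameter : ∀ {n} → Graph n → Maybe ℕ → Set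
IsDiameter {n} G nothing  = Σ (Fin n) λ s → Σ (Fin n) λ t → ¬ Reachable G s t
IsDiameter {n} G (just D) =
  (∀ s t → Σ ℕ λ d → d ≤ D × IsDist G s t d) ×
  (Σ (Fin n) λ s → Σ (Fin n) λ t → IsDist G s t D)

Connected : ∀ {n} → Graph n → Set
Connected G = ∀ s t → Reachable G s t

data Token (n : ℕ) : Set where
  vtx  : Fin n → Token n            -- start of the list of vertex v
  edge : Fin n → Fin n → Token n    -- edge {v,u} seen at v

ALStream : ∀ {n} → Graph n → List (Token n) → Set
ALStream {n} G s =
  Σ (List (Fin n)) λ σ → σ ↭ allFin n ×
  Σ (Fin n → List (Fin n)) λ nb → (∀ v → nb v ↭ nbrs G v) ×
  s ≡ concatMap (λ v → vtx v ∷ map (edge v) (nb v)) σ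

-- The given vertex cover X is the extra input; it is only available
-- through the initial memory state. Computation is unlimited (arbitrary
-- functions); the memory is exactly the m-bit state between tokens.

Mem : ℕ → Set
Mem m = Vec Bool m

record StreamAlg (n m : ℕ) (O : Set) : Set where
  field
    init : Subset n → Mem m
    next : Mem m → Token n → Mem m
    out  : Mem m → O
open StreamAlg public

passes : ∀ {n m} → (Mem m → Token n → Mem m) → ℕ → Mem m → List (Token n) → Mem m
passes f zero    st s = st
passes f (suc p) st s = passes f p (foldl f st s) s

run : ∀ {n m O} → StreamAlg n m O → ℕ → Subset n → List (Token n) → O
run A p X s = out A (passes (next A) p (init A X) s)

Solvable : (O : Set) → (∀ {n} → Graph n → O → Set) → (n k p m : ℕ) → Set
Solvable O Correct n k p m =
  Σ (StreamAlg n m O) λ A →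
    ∀ (G : Graph n) (X : Subset n) → ∣ X ∣ ≡ k → IsVertexCover G X →
    ∀ s → ALStream G s → Correct G (run A p X s)

DiameterCorrect : ∀ {n} → Graph n → Maybe ℕ → Set
DiameterCorrect G o = IsDiameter G o

ConnectivityCorrect : ∀ {n} → Graph n → Bool → Set
ConnectivityCorrect G b = (b ≡ true → Connected G) × (Connected G → b ≡ true)

module Submission where

-- Outside the vertex cover X the graph is independent, so a vertex v ∉ X matters only
-- through its type N(v) ∩ X, and vertices of equal type are at equal distance from all
-- other vertices. It therefore suffices to search breadth-first from the k cover
-- vertices and from one vertex of each occurring type, and such a search is described
-- by the sets of cover vertices within distance r and r + 1 of the source: one pass over
-- an adjacency-list stream advances them by a layer and decides whether all vertices are
-- reached, because every vertex contributes a function of its type alone. A search gains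
-- a cover vertex every two layers until it stalls, so finite eccentricities are at most
-- 2k + 1, and (k + 2^k)(2k + 4) passes with O(k) bits of search state, plus O(k log n)
-- bits for X and the vertex being read, yield the largest eccentricity, i.e. the diameter.
-- For one pass, store instead how often each type occurs (capped at two) and the
-- adjacency inside X: from these 2^(k+1) + k² bits the summary of every pass above can be
-- computed, so the multi-pass computation is carried out after the stream has ended.
-- Connectivity is finiteness of the diameter.


module Walks where

  open import Defs hiding (sym)
  open import Data.Bool using (true)
  open import Data.Bool.Properties using () renaming (_≟_ to _≟ᵇ_)
  open import Data.Nat using (ℕ; zero; suc; _≤_; _<_; z≤n; s≤s)
  open import Data.Nat.Properties using (≤-trans; <-≤-trans; ≤-refl; n≤1+n; ≤-pred; m≤n⇒m<n∨m≡n; ≤-<-connex)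
  open import Data.Fin using (Fin)
  open import Data.Fin.Properties using (any?; _≟_)
  open import Data.Product using (Σ; _×_; _,_)
  open import Data.Sum using (_⊎_; inj₁; inj₂; [_,_]′)
  open import Relation.Nullary using (Dec; yes; no; contradiction)
  open import Relation.Nullary.Decidable using (_×-dec_)
  open import Relation.Binary.PropositionalEquality using (_≡_; refl)

  module BoundedWalks {n} (G : Graph n) where
    snoc : ∀ {s u t ℓ} → Walk G s u ℓ → adj G u t ≡ true → Walk G s t (suc ℓ)
    snoc here e = step e here
    snoc (step e w) e' = step e (snoc w e')

    unsnoc : ∀ {s t ℓ} → Walk G s t (suc ℓ) → Σ (Fin n) λ u → Walk G s u ℓ × adj G u t ≡ true
    unsnoc {ℓ = zero} (step e here) = _ , here , e
    unsnoc {ℓ = suc ℓ} (step e w) with unsnoc w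
    ... | u , w' , e' = u , step e w' , e'

    Within : ℕ → Fin n → Fin n → Set
    Within b s t = Σ ℕ λ ℓ → ℓ < b × Walk G s t ℓ

    Within-refl : ∀ {b s} → Within (suc b) s s
    Within-refl = zero , s≤s z≤n , here

    Within-mono : ∀ {b b' s t} → b ≤ b' → Within b s t → Within b' s t
    Within-mono le (ℓ , lt , w) = ℓ , <-≤-trans lt le , w

    Within-last : ∀ {b s t} → Within (suc b) s t → (s ≡ t) ⊎ (Σ (Fin n) λ u → Within b s u × adj G u t ≡ true)
    Within-last (zero , lt , here) = inj₁ refl
    Within-last (suc ℓ , s≤s lt , w) with unsnoc w
    ... | u , w' , e = inj₂ (u , (ℓ , lt , w') , e)

    Within-last⁻ : ∀ {b s t} → (s ≡ t) ⊎ (Σ (Fin n) λ u → Within b s u × adj G u t ≡ true) → Within (suc b) s t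
    Within-last⁻ (inj₁ refl) = Within-refl
    Within-last⁻ (inj₂ (u , (ℓ , lt , w) , e)) = suc ℓ , s≤s lt , snoc w e

    Within-first : ∀ {b s t} → Within (suc b) s t → (s ≡ t) ⊎ (Σ (Fin n) λ u → adj G s u ≡ true × Within b u t)
    Within-first (zero , lt , here) = inj₁ refl
    Within-first (suc ℓ , s≤s lt , step e w) = inj₂ (_ , e , (ℓ , lt , w))

    Within? : ∀ b s t → Dec (Within b s t)
    Within? zero s t = no λ { (ℓ , () , _) }
    Within? (suc b) s t with s ≟ t
    ... | yes refl = yes Within-refl
    ... | no s≢t with any? (λ u → (adj G s u ≟ᵇ true) ×-dec Within? b u t)
    ...   | yes (u , e , (ℓ , lt , w)) = yes (suc ℓ , s≤s lt , step e w)
    ...   | no none = no λ w → [ s≢t , none ]′ (Within-first w)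

    distance-within : ∀ r {s t} → Within (suc r) s t → Σ ℕ λ d → d ≤ r × IsDist G s t d
    distance-within zero (zero , _ , here) = zero , z≤n , here , λ _ _ → z≤n
    distance-within zero (suc ℓ , s≤s () , _)
    distance-within (suc r) {s} {t} w with Within? (suc r) s t
    ... | yes w' with distance-within r w'
    ...   | d , le , isd = d , ≤-trans le (n≤1+n r) , isd
    distance-within (suc r) {s} {t} (ℓ , lt , w) | no far with m≤n⇒m<n∨m≡n (≤-pred lt)
    ...   | inj₁ ℓ<r = contradiction (ℓ , ℓ<r , w) far
    ...   | inj₂ refl = suc r , ≤-refl , w , shortest
      where
        shortest : ∀ ℓ' → Walk G s t ℓ' → suc r ≤ ℓ'
        shortest ℓ' w' with ≤-<-connex ℓ' r
        ... | inj₁ ℓ'≤r = contradiction (ℓ' , s≤s ℓ'≤r , w') far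
        ... | inj₂ r<ℓ' = r<ℓ'



module Monoids where

  open import Data.Bool using (Bool; true; false; _∨_; _∧_)
  open import Data.Bool.Properties using (∨-assoc; ∨-comm; ∧-assoc; ∧-comm; ∨-idem; ∧-idem)
  open import Data.Bool.Solver using (module ∨-∧-Solver)
  open import Data.Nat using (ℕ; zero; suc)
  open import Data.Fin using (Fin; zero; suc)
  open import Data.List using (List; []; _∷_; tabulate)
  open import Data.List.Relation.Binary.Permutation.Propositional as ↭ using (_↭_)
  open import Data.Vec using (Vec; []; _∷_; zipWith; replicate; lookup)
  open import Data.Product using (_×_; _,_)
  open import Relation.Binary.PropositionalEquality using (_≡_; refl; sym; trans; cong; cong₂)
  open Relation.Binary.PropositionalEquality.≡-Reasoning

  record ComMonoid : Set₁ where
    field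
      Carrier : Set
      ε : Carrier
      _⊕_ : Carrier → Carrier → Carrier
      assoc : ∀ a b c → (a ⊕ b) ⊕ c ≡ a ⊕ (b ⊕ c)
      comm : ∀ a b → a ⊕ b ≡ b ⊕ a
      identityˡ : ∀ a → ε ⊕ a ≡ a

  module ComMonoidOps (Mo : ComMonoid) where
    open ComMonoid Mo

    identityʳ : ∀ a → a ⊕ ε ≡ a
    identityʳ a = trans (comm a ε) (identityˡ a)

    swap-mid : ∀ a b c → a ⊕ (b ⊕ c) ≡ b ⊕ (a ⊕ c)
    swap-mid a b c = trans (sym (assoc a b c)) (trans (cong (_⊕ c) (comm a b)) (assoc b a c))

    interchange : ∀ a b c d → (a ⊕ b) ⊕ (c ⊕ d) ≡ (a ⊕ c) ⊕ (b ⊕ d)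
    interchange a b c d = begin
      (a ⊕ b) ⊕ (c ⊕ d)  ≡⟨ assoc a b (c ⊕ d) ⟩
      a ⊕ (b ⊕ (c ⊕ d))  ≡⟨ cong (a ⊕_) (swap-mid b c d) ⟩
      a ⊕ (c ⊕ (b ⊕ d))  ≡⟨ sym (assoc a c (b ⊕ d)) ⟩
      (a ⊕ c) ⊕ (b ⊕ d)  ∎

    fold : {A : Set} → (A → Carrier) → List A → Carrier
    fold g [] = ε
    fold g (x ∷ xs) = g x ⊕ fold g xs

    fold-cong : {A : Set} {f g : A → Carrier} → (∀ x → f x ≡ g x) → ∀ xs → fold f xs ≡ fold g xs
    fold-cong eq [] = refl
    fold-cong eq (x ∷ xs) = cong₂ _⊕_ (eq x) (fold-cong eq xs)

    fold-↭ : {A : Set} (g : A → Carrier) {xs ys : List A} → xs ↭ ys → fold g xs ≡ fold g ys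
    fold-↭ g ↭.refl = refl
    fold-↭ g (↭.prep x p) = cong (g x ⊕_) (fold-↭ g p)
    fold-↭ g (↭.swap x y p) = trans (swap-mid (g x) (g y) _) (cong (λ z → g y ⊕ (g x ⊕ z)) (fold-↭ g p))
    fold-↭ g (↭.trans p q) = trans (fold-↭ g p) (fold-↭ g q)

    foldF : ∀ {n} → (Fin n → Carrier) → Carrier
    foldF {zero} g = ε
    foldF {suc n} g = g zero ⊕ foldF (λ i → g (suc i))

    fold-tabulate : ∀ {A : Set} {n} (g : A → Carrier) (f : Fin n → A) → fold g (tabulate f) ≡ foldF (λ i → g (f i))
    fold-tabulate {n = zero} g f = refl
    fold-tabulate {n = suc n} g f = cong (g (f zero) ⊕_) (fold-tabulate g (λ i → f (suc i)))

    foldF-⊕ : ∀ {n} (f g : Fin n → Carrier) → foldF (λ i → f i ⊕ g i) ≡ foldF f ⊕ foldF g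
    foldF-⊕ {zero} f g = sym (identityˡ ε)
    foldF-⊕ {suc n} f g =
      trans (cong ((f zero ⊕ g zero) ⊕_) (foldF-⊕ (λ i → f (suc i)) (λ i → g (suc i))))
            (interchange (f zero) (g zero) _ _)

    foldF-ε : ∀ {n} → foldF {n} (λ _ → ε) ≡ ε
    foldF-ε {zero} = refl
    foldF-ε {suc n} = trans (identityˡ _) (foldF-ε {n})

    foldF-cong : ∀ {n} {f g : Fin n → Carrier} → (∀ i → f i ≡ g i) → foldF f ≡ foldF g
    foldF-cong {zero} eq = refl
    foldF-cong {suc n} eq = cong₂ _⊕_ (eq zero) (foldF-cong (λ i → eq (suc i)))

  orV : ∀ {k} → Vec Bool k → Vec Bool k → Vec Bool k
  orV = zipWith _∨_

  zeros : ∀ {k} → Vec Bool k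
  zeros = replicate _ false

  orV-assoc : ∀ {k} (a b c : Vec Bool k) → orV (orV a b) c ≡ orV a (orV b c)
  orV-assoc [] [] [] = refl
  orV-assoc (x ∷ a) (y ∷ b) (z ∷ c) = cong₂ _∷_ (∨-assoc x y z) (orV-assoc a b c)

  orV-comm : ∀ {k} (a b : Vec Bool k) → orV a b ≡ orV b a
  orV-comm [] [] = refl
  orV-comm (x ∷ a) (y ∷ b) = cong₂ _∷_ (∨-comm x y) (orV-comm a b)

  orV-identityˡ : ∀ {k} (a : Vec Bool k) → orV zeros a ≡ a
  orV-identityˡ [] = refl
  orV-identityˡ (x ∷ a) = cong (x ∷_) (orV-identityˡ a)

  orV-idem : ∀ {k} (a : Vec Bool k) → orV a a ≡ a
  orV-idem [] = refl
  orV-idem (x ∷ a) = cong₂ _∷_ (∨-idem x) (orV-idem a)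

  lookup-orV : ∀ {k} (a b : Vec Bool k) j → lookup (orV a b) j ≡ lookup a j ∨ lookup b j
  lookup-orV (x ∷ a) (y ∷ b) zero = refl
  lookup-orV (x ∷ a) (y ∷ b) (suc j) = lookup-orV a b j

  lookup-zeros : ∀ {k} (j : Fin k) → lookup (zeros {k}) j ≡ false
  lookup-zeros zero = refl
  lookup-zeros (suc j) = lookup-zeros j

  -- (a₁ , a₂) records "at least one" and "at least two": a count saturated at two.
  Count : Set
  Count = Bool × Bool

  _⊕c_ : Count → Count → Count
  (a₁ , a₂) ⊕c (b₁ , b₂) = (a₁ ∨ b₁) , (a₂ ∨ b₂ ∨ (a₁ ∧ b₁))

  count0 : Count
  count0 = false , false

  open ∨-∧-Solver using (solve; _:+_; _:*_; _:=_)

  ⊕c-assoc : ∀ a b c → (a ⊕c b) ⊕c c ≡ a ⊕c (b ⊕c c)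
  ⊕c-assoc (a₁ , a₂) (b₁ , b₂) (c₁ , c₂) = cong₂ _,_ (∨-assoc a₁ b₁ c₁)
    (solve 6 (λ a₁ a₂ b₁ b₂ c₁ c₂ →
                 (a₂ :+ (b₂ :+ (a₁ :* b₁))) :+ (c₂ :+ ((a₁ :+ b₁) :* c₁))
              := a₂ :+ ((b₂ :+ (c₂ :+ (b₁ :* c₁))) :+ (a₁ :* (b₁ :+ c₁))))
           refl a₁ a₂ b₁ b₂ c₁ c₂)

  ⊕c-comm : ∀ a b → a ⊕c b ≡ b ⊕c a
  ⊕c-comm (a₁ , a₂) (b₁ , b₂) = cong₂ _,_ (∨-comm a₁ b₁)
    (solve 4 (λ a₁ a₂ b₁ b₂ → a₂ :+ (b₂ :+ (a₁ :* b₁)) := b₂ :+ (a₂ :+ (b₁ :* a₁))) refl a₁ a₂ b₁ b₂)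

  ⊕c-identityˡ : ∀ a → count0 ⊕c a ≡ a
  ⊕c-identityˡ (a₁ , false) = refl
  ⊕c-identityˡ (a₁ , true) = refl

  ⊕c-triple : ∀ a → a ⊕c (a ⊕c a) ≡ a ⊕c a
  ⊕c-triple (false , false) = refl
  ⊕c-triple (false , true) = refl
  ⊕c-triple (true , false) = refl
  ⊕c-triple (true , true) = refl

  -- What a pass computes for a search: how many vertices outside the cover have the
  -- source's type, the cover vertices reached next, and whether all vertices are reached.
  Summary : ℕ → Set
  Summary k = Count × Vec Bool k × Bool

  εS : ∀ {k} → Summary k
  εS = count0 , zeros , true

  _⊕M_ : ∀ {k} → Summary k → Summary k → Summary k
  (c , a , x) ⊕M (d , b , y) = (c ⊕c d) , orV a b , (x ∧ y)

  summaryMonoid : ℕ → ComMonoid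
  summaryMonoid k = record
    { Carrier = Summary k ; ε = εS ; _⊕_ = _⊕M_
    ; assoc = λ { (c , a , x) (d , b , y) (f , g , z) → cong₂ _,_ (⊕c-assoc c d f) (cong₂ _,_ (orV-assoc a b g) (∧-assoc x y z)) }
    ; comm = λ { (c , a , x) (d , b , y) → cong₂ _,_ (⊕c-comm c d) (cong₂ _,_ (orV-comm a b) (∧-comm x y)) }
    ; identityˡ = λ { (c , a , x) → cong₂ _,_ (⊕c-identityˡ c) (cong₂ _,_ (orV-identityˡ a) refl) }
    }

  ⊕M-triple : ∀ {k} (a : Summary k) → a ⊕M (a ⊕M a) ≡ a ⊕M a
  ⊕M-triple (c , a , x) = cong₂ _,_ (⊕c-triple c) (cong₂ _,_ (cong (orV a) (orV-idem a)) (cong (x ∧_) (∧-idem x)))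


module BooleanTests where

  open import Data.Bool using (Bool; true; false; _∨_; _∧_)
  open import Data.Bool.Properties using () renaming (_≟_ to _≟ᵇ_)
  open import Data.Nat using (zero; suc)
  open import Data.Fin using (Fin; zero; suc)
  open import Data.Fin.Properties using (_≟_)
  open import Data.Vec using (Vec; []; _∷_; lookup)
  open import Data.Vec.Properties using (≡-dec)
  open import Data.Product using (Σ; _×_; _,_; proj₁; proj₂)
  open import Data.Sum using (_⊎_; inj₁; inj₂)
  open import Relation.Nullary using (Dec; yes; does)
  open import Relation.Nullary.Decidable using (dec-true)
  open import Relation.Binary.PropositionalEquality using (_≡_; refl; sym; cong₂)

  does-true : ∀ {A : Set} (d : Dec A) → does d ≡ true → A
  does-true (yes a) _ = a

  eqF : ∀ {n} → Fin n → Fin n → Bool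
  eqF u v = does (u ≟ v)

  eqF-true : ∀ {n} {u v : Fin n} → eqF u v ≡ true → u ≡ v
  eqF-true {u = u} {v} = does-true (u ≟ v)

  eqF-refl : ∀ {n} (u : Fin n) → eqF u u ≡ true
  eqF-refl u = dec-true (u ≟ u) refl

  eqV : ∀ {k} → Vec Bool k → Vec Bool k → Bool
  eqV a b = does (≡-dec _≟ᵇ_ a b)

  eqV-true : ∀ {k} {a b : Vec Bool k} → eqV a b ≡ true → a ≡ b
  eqV-true {a = a} {b} = does-true (≡-dec _≟ᵇ_ a b)

  eqV-refl : ∀ {k} (a : Vec Bool k) → eqV a a ≡ true
  eqV-refl a = dec-true (≡-dec _≟ᵇ_ a a) refl

  anyF : ∀ {k} → (Fin k → Bool) → Bool
  anyF {zero} f = false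
  anyF {suc k} f = f zero ∨ anyF (λ j → f (suc j))

  allF : ∀ {k} → (Fin k → Bool) → Bool
  allF {zero} f = true
  allF {suc k} f = f zero ∧ allF (λ j → f (suc j))

  ∨-true : ∀ a b → a ∨ b ≡ true → (a ≡ true) ⊎ (b ≡ true)
  ∨-true true b e = inj₁ refl
  ∨-true false b e = inj₂ e

  ∧-true : ∀ a b → a ∧ b ≡ true → (a ≡ true) × (b ≡ true)
  ∧-true true true e = refl , refl

  ∨-introˡ : ∀ {a b} → a ≡ true → a ∨ b ≡ true
  ∨-introˡ refl = refl

  ∨-introʳ : ∀ a {b} → b ≡ true → a ∨ b ≡ true
  ∨-introʳ true p = refl
  ∨-introʳ false p = p

  ∧-intro : ∀ {a b} → a ≡ true → b ≡ true → a ∧ b ≡ true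
  ∧-intro refl refl = refl

  anyF-true : ∀ {k} (f : Fin k → Bool) → anyF f ≡ true → Σ (Fin k) λ j → f j ≡ true
  anyF-true {suc k} f e with ∨-true (f zero) _ e
  ... | inj₁ p = zero , p
  ... | inj₂ p with anyF-true (λ j → f (suc j)) p
  ...   | j , q = suc j , q

  anyF-intro : ∀ {k} (f : Fin k → Bool) j → f j ≡ true → anyF f ≡ true
  anyF-intro {suc k} f zero p rewrite p = refl
  anyF-intro {suc k} f (suc j) p with f zero
  ... | true = refl
  ... | false = anyF-intro (λ j → f (suc j)) j p

  allF-true : ∀ {k} (f : Fin k → Bool) → allF f ≡ true → ∀ j → f j ≡ true
  allF-true {suc k} f e zero = proj₁ (∧-true (f zero) _ e)
  allF-true {suc k} f e (suc j) = allF-true (λ j → f (suc j)) (proj₂ (∧-true (f zero) _ e)) j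

  allF-intro : ∀ {k} (f : Fin k → Bool) → (∀ j → f j ≡ true) → allF f ≡ true
  allF-intro {zero} f p = refl
  allF-intro {suc k} f p rewrite p zero = allF-intro (λ j → f (suc j)) (λ j → p (suc j))

  vec-ext : ∀ {A : Set} {k} (a b : Vec A k) → (∀ j → lookup a j ≡ lookup b j) → a ≡ b
  vec-ext [] [] p = refl
  vec-ext (x ∷ a) (y ∷ b) p = cong₂ _∷_ (p zero) (vec-ext a b (λ j → p (suc j)))

  bool-ext : ∀ {a b : Bool} → (a ≡ true → b ≡ true) → (b ≡ true → a ≡ true) → a ≡ b
  bool-ext {true} {true} f g = refl
  bool-ext {true} {false} f g = sym (f refl)
  bool-ext {false} {true} f g = g refl
  bool-ext {false} {false} f g = refl


module Contributions where

  open Monoids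
  open BooleanTests
  open import Data.Bool using (Bool; true; false; _∨_; _∧_; not; if_then_else_)
  open import Data.Nat using (ℕ)
  open import Data.Fin using (Fin)
  open import Data.Vec using (Vec; lookup; map)
  open import Data.Product using (_,_)

  -- A breadth-first search is started from every cover vertex and from (one vertex
  -- of) every type, a type being the set of cover vertices adjacent to a vertex
  -- outside the cover, as a vector indexed by the enumeration of the cover.
  data Source (k : ℕ) : Set where
    fromCover : Fin k → Source k
    fromType : Vec Bool k → Source k

  isSourceType : ∀ {k} → Source k → Vec Bool k → Bool
  isSourceType (fromCover _) T = false
  isSourceType (fromType T₀) T = eqV T T₀

  mask : ∀ {k} → Bool → Vec Bool k → Vec Bool k
  mask b T = map (b ∧_) T

  exactlyOne : Count → Bool
  exactlyOne (a₁ , a₂) = a₁ ∧ not a₂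

  module Contribution {n k : ℕ} (xs : Vec (Fin n) k) where
    inCoverᵇ : Fin n → Bool
    inCoverᵇ v = anyF (λ j → eqF (lookup xs j) v)

    reachedᵇ : Vec Bool k → Fin n → Bool
    reachedᵇ A v = anyF (λ j → eqF (lookup xs j) v ∧ lookup A j)

    meetsᵇ : Vec Bool k → Vec Bool k → Bool
    meetsᵇ T A' = anyF (λ j → lookup T j ∧ lookup A' j)

    -- In round r, A and A' are the cover vertices within distance r + 1 and r of the
    -- source. A vertex outside the cover is within r + 1 iff it meets A' or is the
    -- source itself; and a vertex of the source's type is known to be the source
    -- only when that type occurs exactly once, as recorded by c.
    contribIndependent : Source k → Count → Vec Bool k → Vec Bool k → Summary k
    contribIndependent src c A' T =
      (isSourceType src T , false) ,
      mask (isSourceType src T ∨ meetsᵇ T A') T ,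
      ((isSourceType src T ∧ exactlyOne c) ∨ meetsᵇ T A')

    contribCover : Vec Bool k → Fin n → Vec Bool k → Summary k
    contribCover A v T = count0 , mask (reachedᵇ A v) T , true

    contrib : Source k → Count → Vec Bool k → Vec Bool k → Fin n → Vec Bool k → Summary k
    contrib src c A A' v T = if inCoverᵇ v then contribCover A v T else contribIndependent src c A' T

    markNeighbour : Fin n → Vec Bool k → Vec Bool k
    markNeighbour u T = orV T (map (λ x → eqF x u) xs)

    initialReached : Source k → Vec Bool k
    initialReached (fromCover j₀) = map (λ x → eqF x (lookup xs j₀)) xs
    initialReached (fromType T) = zeros


module SummaryFolds where

  open Monoids
  open BooleanTests
  open import Data.Bool using (Bool; true; false)
  open import Data.Nat using (ℕ; zero; suc)
  open import Data.Fin using (Fin; zero; suc)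
  open import Data.Fin.Properties using (suc-injective)
  open import Data.Vec using (Vec; lookup)
  open import Data.Product using (Σ; _×_; _,_; proj₁; proj₂)
  open import Data.Sum using (inj₁; inj₂)
  open import Relation.Nullary using (¬_; contradiction)
  open import Relation.Binary.PropositionalEquality using (_≡_; refl; sym; trans; cong; cong₂)

  module _ {k : ℕ} where
    open ComMonoidOps (summaryMonoid k)

    countOf : Summary k → Count
    countOf = proj₁

    reachedOf : Summary k → Vec Bool k
    reachedOf m = proj₁ (proj₂ m)

    coveredOf : Summary k → Bool
    coveredOf m = proj₂ (proj₂ m)

    atLeastOne atLeastTwo : Summary k → Bool
    atLeastOne m = proj₁ (countOf m)
    atLeastTwo m = proj₂ (countOf m)

    reached-foldF⇒ : ∀ {n} (g : Fin n → Summary k) j → lookup (reachedOf (foldF g)) j ≡ true →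
                     Σ (Fin n) λ v → lookup (reachedOf (g v)) j ≡ true
    reached-foldF⇒ {zero} g j e = contradiction (trans (sym (lookup-zeros j)) e) (λ ())
    reached-foldF⇒ {suc n} g j e with ∨-true (lookup (reachedOf (g zero)) j) _
                                        (trans (sym (lookup-orV (reachedOf (g zero)) _ j)) e)
    ... | inj₁ p = zero , p
    ... | inj₂ p with reached-foldF⇒ (λ v → g (suc v)) j p
    ...   | v , q = suc v , q

    reached-foldF⇐ : ∀ {n} (g : Fin n → Summary k) j v → lookup (reachedOf (g v)) j ≡ true →
                     lookup (reachedOf (foldF g)) j ≡ true
    reached-foldF⇐ {suc n} g j zero p =
      trans (lookup-orV (reachedOf (g zero)) _ j) (∨-introˡ p)
    reached-foldF⇐ {suc n} g j (suc v) p =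
      trans (lookup-orV (reachedOf (g zero)) _ j) (∨-introʳ (lookup (reachedOf (g zero)) j) (reached-foldF⇐ (λ v → g (suc v)) j v p))

    covered-foldF⇒ : ∀ {n} (g : Fin n → Summary k) → coveredOf (foldF g) ≡ true → ∀ v → coveredOf (g v) ≡ true
    covered-foldF⇒ {suc n} g e zero = proj₁ (∧-true (coveredOf (g zero)) _ e)
    covered-foldF⇒ {suc n} g e (suc v) = covered-foldF⇒ (λ v → g (suc v)) (proj₂ (∧-true (coveredOf (g zero)) _ e)) v

    covered-foldF⇐ : ∀ {n} (g : Fin n → Summary k) → (∀ v → coveredOf (g v) ≡ true) → coveredOf (foldF g) ≡ true
    covered-foldF⇐ {zero} g p = refl
    covered-foldF⇐ {suc n} g p = ∧-intro (p zero) (covered-foldF⇐ (λ v → g (suc v)) (λ v → p (suc v)))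

    atLeastOne-foldF⇐ : ∀ {n} (g : Fin n → Summary k) v → atLeastOne (g v) ≡ true → atLeastOne (foldF g) ≡ true
    atLeastOne-foldF⇐ {suc n} g zero p = ∨-introˡ p
    atLeastOne-foldF⇐ {suc n} g (suc v) p = ∨-introʳ (atLeastOne (g zero)) (atLeastOne-foldF⇐ (λ v → g (suc v)) v p)

    atLeastOne-foldF⇒ : ∀ {n} (g : Fin n → Summary k) → atLeastOne (foldF g) ≡ true →
                        Σ (Fin n) λ v → atLeastOne (g v) ≡ true
    atLeastOne-foldF⇒ {suc n} g e with ∨-true (atLeastOne (g zero)) _ e
    ... | inj₁ p = zero , p
    ... | inj₂ p with atLeastOne-foldF⇒ (λ v → g (suc v)) p
    ...   | v , q = suc v , q

    atLeastTwo-foldF⇐ : ∀ {n} (g : Fin n → Summary k) v w → ¬ v ≡ w → atLeastOne (g v) ≡ true →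
                        atLeastOne (g w) ≡ true → atLeastTwo (foldF g) ≡ true
    atLeastTwo-foldF⇐ {suc n} g zero zero v≢w p q = contradiction refl v≢w
    atLeastTwo-foldF⇐ {suc n} g zero (suc w) v≢w p q =
      ∨-introʳ (atLeastTwo (g zero)) (∨-introʳ (atLeastTwo (foldF (λ v → g (suc v)))) (∧-intro p (atLeastOne-foldF⇐ (λ v → g (suc v)) w q)))
    atLeastTwo-foldF⇐ {suc n} g (suc v) zero v≢w p q =
      ∨-introʳ (atLeastTwo (g zero)) (∨-introʳ (atLeastTwo (foldF (λ v → g (suc v)))) (∧-intro q (atLeastOne-foldF⇐ (λ v → g (suc v)) v p)))
    atLeastTwo-foldF⇐ {suc n} g (suc v) (suc w) v≢w p q =
      ∨-introʳ (atLeastTwo (g zero)) (∨-introˡ (atLeastTwo-foldF⇐ (λ v → g (suc v)) v w (λ e → v≢w (cong suc e)) p q))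

    atLeastTwo-foldF⇒ : ∀ {n} (g : Fin n → Summary k) → (∀ v → atLeastTwo (g v) ≡ false) →
                        atLeastTwo (foldF g) ≡ true →
                        Σ (Fin n) λ v → Σ (Fin n) λ w → (¬ v ≡ w) × atLeastOne (g v) ≡ true × atLeastOne (g w) ≡ true
    atLeastTwo-foldF⇒ {suc n} g single e with ∨-true (atLeastTwo (g zero)) _ e
    ... | inj₁ p = contradiction (trans (sym p) (single zero)) (λ ())
    ... | inj₂ p with ∨-true (atLeastTwo (foldF (λ v → g (suc v)))) _ p
    ...   | inj₁ q with atLeastTwo-foldF⇒ (λ v → g (suc v)) (λ v → single (suc v)) q
    ...     | v , w , v≢w , a , b = suc v , suc w , (λ eq → v≢w (suc-injective eq)) , a , b
    atLeastTwo-foldF⇒ {suc n} g single e | inj₂ p | inj₂ q with ∧-true (atLeastOne (g zero)) _ q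
    ... | a , b with atLeastOne-foldF⇒ (λ v → g (suc v)) b
    ...   | w , c = zero , suc w , (λ ()) , a , c

    count-foldF-cong : ∀ {n} (g g' : Fin n → Summary k) → (∀ v → countOf (g v) ≡ countOf (g' v)) →
                       countOf (foldF g) ≡ countOf (foldF g')
    count-foldF-cong {zero} g g' p = refl
    count-foldF-cong {suc n} g g' p =
      cong₂ _⊕c_ (p zero) (count-foldF-cong (λ v → g (suc v)) (λ v → g' (suc v)) (λ v → p (suc v)))


module LayerSearch where

  open import Defs renaming (sym to adj-symmetric)
  open Monoids
  open BooleanTests
  open Contributions
  open SummaryFolds
  open Walks
  open import Data.Bool using (Bool; true; false; _∨_; _∧_; not)
  open import Data.Nat using (ℕ; zero; suc; _+_; _≤_; _<_; s≤s)
  open import Data.Nat.Properties using (≤-refl; n≤1+n; ≤-trans; +-suc; +-mono-≤; m≤m+n; <-irrefl; ≤-<-trans)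
  open import Data.Fin using (Fin; zero; suc)
  open import Data.Fin.Properties using (all?; ¬∀⟶∃¬) renaming (_≟_ to _≟ᶠ_)
  open import Data.Fin.Subset using (Subset; _∈_; _⊂_; ∣_∣)
  open import Data.Fin.Subset.Properties using (p⊂q⇒∣p∣<∣q∣; ∣p∣≤n)
  open import Data.Vec using (Vec; lookup; map; tabulate)
  open import Data.Vec.Properties using (lookup-map; lookup∘tabulate; []=⇒lookup; lookup⇒[]=)
  open import Data.Product using (Σ; _×_; _,_; proj₁; proj₂)
  open import Data.Sum using (_⊎_; inj₁; inj₂)
  open import Relation.Nullary using (¬_; yes; no; does; contradiction)
  open import Relation.Nullary.Decidable using (_→-dec_; decidable-stable; dec-true)
  open import Relation.Binary.PropositionalEquality using (_≡_; refl; sym; trans; cong; subst)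

  InCover : ∀ {n k} → Vec (Fin n) k → Fin n → Set
  InCover {k = k} xs u = Σ (Fin k) λ j → lookup xs j ≡ u

  module Layers {n k : ℕ} (G : Graph n) (xs : Vec (Fin n) k)
    (cover : ∀ u v → adj G u v ≡ true → InCover xs u ⊎ InCover xs v) where
    open Contribution xs
    open BoundedWalks G
    open ComMonoidOps (summaryMonoid k)

    typeOf : Fin n → Vec Bool k
    typeOf v = map (adj G v) xs

    lookup-typeOf : ∀ v j → lookup (typeOf v) j ≡ adj G v (lookup xs j)
    lookup-typeOf v j = lookup-map j (adj G v) xs

    adj-sym : ∀ {u v} → adj G u v ≡ true → adj G v u ≡ true
    adj-sym {u} {v} e = trans (adj-symmetric G v u) e

    lookup-mask : ∀ (b : Bool) (T : Vec Bool k) j → lookup (mask b T) j ≡ (b ∧ lookup T j)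
    lookup-mask b T j = lookup-map j (b ∧_) T

    inCoverᵇ⇒ : ∀ {v} → inCoverᵇ v ≡ true → InCover xs v
    inCoverᵇ⇒ e with anyF-true _ e
    ... | j , p = j , eqF-true p

    inCoverᵇ⇐ : ∀ {v} → InCover xs v → inCoverᵇ v ≡ true
    inCoverᵇ⇐ (j , refl) = anyF-intro _ j (eqF-refl (lookup xs j))

    notInCoverᵇ⇒ : ∀ {v} → inCoverᵇ v ≡ false → ¬ InCover xs v
    notInCoverᵇ⇒ e p = contradiction (trans (sym (inCoverᵇ⇐ p)) e) (λ ())

    notInCoverᵇ⇐ : ∀ {v} → ¬ InCover xs v → inCoverᵇ v ≡ false
    notInCoverᵇ⇐ {v} ni with inCoverᵇ v in ev
    ... | true = contradiction (inCoverᵇ⇒ ev) ni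
    ... | false = refl

    Within-extend : ∀ {b i v j} → Within (suc b) i v → lookup (typeOf v) j ≡ true → Within (suc (suc b)) i (lookup xs j)
    Within-extend {v = v} {j} w t = Within-last⁻ (inj₂ (v , w , trans (sym (lookup-typeOf v j)) t))

    passSummary : Source k → Count → Vec Bool k → Vec Bool k → Summary k
    passSummary src c A A' = foldF (λ v → contrib src c A A' v (typeOf v))

    sourceCount : Source k → Count
    sourceCount src = countOf (passSummary src count0 zeros zeros)

    data Represents : Source k → Fin n → Set where
      viaCover : ∀ {i} j → lookup xs j ≡ i → Represents (fromCover j) i
      viaType : ∀ {i} T → ¬ InCover xs i → typeOf i ≡ T → Represents (fromType T) i

    ReachedSet : ℕ → Fin n → Vec Bool k → Set
    ReachedSet b i A = ∀ j → (lookup A j ≡ true → Within b i (lookup xs j)) × (Within b i (lookup xs j) → lookup A j ≡ true)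

    ReachedSet-0 : ∀ {i} → ReachedSet 0 i zeros
    ReachedSet-0 j = (λ e → contradiction (trans (sym e) (lookup-zeros j)) (λ ())) , (λ { (ℓ , () , _) })

    ReachedSet-initial : ∀ {src i} → Represents src i → ReachedSet 1 i (initialReached src)
    ReachedSet-initial {fromCover j₀} {i} (viaCover .j₀ refl) j = fwd , bwd
      where
        fwd : lookup (initialReached (fromCover j₀)) j ≡ true → Within 1 i (lookup xs j)
        fwd e rewrite lookup-map j (λ x → eqF x (lookup xs j₀)) xs = subst (Within 1 i) (sym (eqF-true e)) Within-refl
        bwd : Within 1 i (lookup xs j) → lookup (initialReached (fromCover j₀)) j ≡ true
        bwd w rewrite lookup-map j (λ x → eqF x (lookup xs j₀)) xs with Within-last w
        ... | inj₁ eq rewrite eq = eqF-refl (lookup xs j)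
        ... | inj₂ (_ , (_ , () , _) , _)
    ReachedSet-initial {fromType T} {i} (viaType .T ni _) j =
      (λ e → contradiction (trans (sym e) (lookup-zeros j)) (λ ())) , bwd
      where
        bwd : Within 1 i (lookup xs j) → lookup zeros j ≡ true
        bwd w with Within-last w
        ... | inj₁ eq = contradiction (j , sym eq) ni
        ... | inj₂ (_ , (_ , () , _) , _)

    meets⇒ : ∀ {r i A' u} → ReachedSet r i A' → meetsᵇ (typeOf u) A' ≡ true → Within (suc r) i u
    meets⇒ {u = u} rep e with anyF-true _ e
    ... | j , p with ∧-true (lookup (typeOf u) j) _ p
    ...   | a , b = Within-last⁻ (inj₂ (lookup xs j , proj₁ (rep j) b , adj-sym (trans (sym (lookup-typeOf u j)) a)))

    meets⇐ : ∀ {r i A' u y} → ReachedSet r i A' → ¬ InCover xs u → Within r i y → adj G y u ≡ true →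
             meetsᵇ (typeOf u) A' ≡ true
    meets⇐ {r} {i} {u = u} rep nu wy e with cover _ u e
    ... | inj₂ p = contradiction p nu
    ... | inj₁ (j , refl) =
      anyF-intro _ j (∧-intro (trans (lookup-typeOf u j) (adj-sym e)) (proj₂ (rep j) wy))

    isSourceType⇒ : ∀ {src i T} → Represents src i → isSourceType src T ≡ true → T ≡ typeOf i
    isSourceType⇒ (viaCover _ _) ()
    isSourceType⇒ (viaType T₀ ni tyi) s = trans (eqV-true s) (sym tyi)

    isSourceType-self : ∀ {src i} → Represents src i → ¬ InCover xs i → isSourceType src (typeOf i) ≡ true
    isSourceType-self (viaCover j p) ni = contradiction (j , p) ni
    isSourceType-self (viaType T₀ ni tyi) _ rewrite tyi = eqV-refl T₀

    nextReached : Source k → Count → Vec Bool k → Vec Bool k → Vec Bool k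
    nextReached src c A A' = orV A (reachedOf (passSummary src c A A'))

    marked⇒ : ∀ {src c A A' r i} → Represents src i → ReachedSet (suc r) i A → ReachedSet r i A' →
              ∀ v j → lookup (reachedOf (contrib src c A A' v (typeOf v))) j ≡ true →
              Within (suc (suc r)) i (lookup xs j)
    marked⇒ {src} {c} {A} {A'} rep rA rA' v j e with inCoverᵇ v
    ... | true with ∧-true (reachedᵇ A v) _ (trans (sym (lookup-mask _ (typeOf v) j)) e)
    ...   | reached , t with anyF-true _ reached
    ...     | j' , p with ∧-true (eqF (lookup xs j') v) _ p
    ...       | q , a = Within-extend (subst (Within _ _) (eqF-true q) (proj₁ (rA j') a)) t
    marked⇒ {src} {c} {A} {A'} {i = i} rep rA rA' v j e | false
      with ∧-true (isSourceType src (typeOf v) ∨ meetsᵇ (typeOf v) A') _ (trans (sym (lookup-mask _ (typeOf v) j)) e)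
    ... | sourceOrMeets , t with ∨-true (isSourceType src (typeOf v)) _ sourceOrMeets
    ...   | inj₂ m = Within-extend (meets⇒ {A' = A'} rA' m) t
    ...   | inj₁ s = Within-extend (Within-refl {s = i}) (subst (λ T → lookup T j ≡ true) (isSourceType⇒ rep s) t)

    marked⇐ : ∀ {src c A A' r i} → Represents src i → ReachedSet (suc r) i A → ReachedSet r i A' →
              ∀ u j → Within (suc r) i u → adj G u (lookup xs j) ≡ true →
              lookup (reachedOf (contrib src c A A' u (typeOf u))) j ≡ true
    marked⇐ {src} {c} {A} {A'} rep rA rA' u j wu e with inCoverᵇ u in eu
    ... | true with inCoverᵇ⇒ eu
    ...   | j' , refl = trans (lookup-mask _ (typeOf u) j)
                          (∧-intro (anyF-intro _ j' (∧-intro (eqF-refl u) (proj₂ (rA j') wu))) (trans (lookup-typeOf u j) e))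
    marked⇐ {src} {c} {A} {A'} rep rA rA' u j wu e | false =
      trans (lookup-mask _ (typeOf u) j) (∧-intro sourceOrMeets (trans (lookup-typeOf u j) e))
      where
        sourceOrMeets : (isSourceType src (typeOf u) ∨ meetsᵇ (typeOf u) A') ≡ true
        sourceOrMeets with Within-last wu
        ... | inj₁ refl = ∨-introˡ (isSourceType-self rep (notInCoverᵇ⇒ eu))
        ... | inj₂ (y , wy , ey) = ∨-introʳ (isSourceType src (typeOf u)) (meets⇐ {A' = A'} rA' (notInCoverᵇ⇒ eu) wy ey)

    ReachedSet-step : ∀ {src c A A' r i} → Represents src i → ReachedSet (suc r) i A → ReachedSet r i A' →
                      ReachedSet (suc (suc r)) i (nextReached src c A A')
    ReachedSet-step {src} {c} {A} {A'} {r} {i} rep rA rA' j = fwd , bwd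
      where
        fwd : lookup (nextReached src c A A') j ≡ true → Within (suc (suc r)) i (lookup xs j)
        fwd e with ∨-true (lookup A j) _ (trans (sym (lookup-orV A _ j)) e)
        ... | inj₁ a = Within-mono (n≤1+n _) (proj₁ (rA j) a)
        ... | inj₂ p with reached-foldF⇒ _ j p
        ...   | v , q = marked⇒ {c = c} {A = A} {A' = A'} rep rA rA' v j q
        bwd : Within (suc (suc r)) i (lookup xs j) → lookup (nextReached src c A A') j ≡ true
        bwd w with Within-last w
        ... | inj₁ eq = trans (lookup-orV A _ j) (∨-introˡ (proj₂ (rA j) (subst (Within _ i) eq Within-refl)))
        ... | inj₂ (u , wu , e) =
          trans (lookup-orV A _ j) (∨-introʳ (lookup A j) (reached-foldF⇐ _ j u (marked⇐ {c = c} {A = A} {A' = A'} rep rA rA' u j wu e)))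

    module TypeCount (src : Source k) where
      g : Fin n → Summary k
      g v = contrib src count0 zeros zeros v (typeOf v)

      single : ∀ v → atLeastTwo (g v) ≡ false
      single v with inCoverᵇ v
      ... | true = refl
      ... | false = refl

      counted⇒ : ∀ v → atLeastOne (g v) ≡ true → (inCoverᵇ v ≡ false) × isSourceType src (typeOf v) ≡ true
      counted⇒ v e with inCoverᵇ v
      ... | false = refl , e

      counted⇐ : ∀ v → inCoverᵇ v ≡ false → isSourceType src (typeOf v) ≡ true → atLeastOne (g v) ≡ true
      counted⇐ v ev e rewrite ev = e

    count-independent : ∀ src c A A' → countOf (passSummary src c A A') ≡ sourceCount src
    count-independent src c A A' = count-foldF-cong _ _ same
      where
        same : ∀ v → countOf (contrib src c A A' v (typeOf v)) ≡ countOf (contrib src count0 zeros zeros v (typeOf v))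
        same v with inCoverᵇ v
        ... | true = refl
        ... | false = refl

    count-unique : ∀ {src i} → Represents src i → exactlyOne (sourceCount src) ≡ true →
                   ∀ u → inCoverᵇ u ≡ false → isSourceType src (typeOf u) ≡ true → u ≡ i
    count-unique (viaCover j p) e u eu ()
    count-unique {fromType T} {i} (viaType .T ni tyi) e u eu su with u ≟ᶠ i
    ... | yes p = p
    ... | no u≢i = contradiction twice (notTwice (proj₂ (∧-true (atLeastOne (foldF g)) _ e)))
      where
        open TypeCount (fromType T)
        notTwice : ∀ {b} → not b ≡ true → ¬ b ≡ true
        notTwice {true} () _
        notTwice {false} _ ()
        twice : atLeastTwo (foldF g) ≡ true
        twice = atLeastTwo-foldF⇐ g u i u≢i (counted⇐ u eu su)
                  (counted⇐ i (notInCoverᵇ⇐ ni) (isSourceType-self (viaType T ni tyi) ni))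

    count-twin : ∀ {src i} → Represents src i → ¬ InCover xs i → exactlyOne (sourceCount src) ≡ false →
                 Σ (Fin n) λ w → (¬ w ≡ i) × inCoverᵇ w ≡ false × typeOf w ≡ typeOf i
    count-twin (viaCover j p) ni e = contradiction (j , p) ni
    count-twin {fromType T} {i} rep@(viaType .T _ _) ni e
      with atLeastTwo-foldF⇒ g single (twice (atLeastOne-foldF⇐ g i (counted⇐ i (notInCoverᵇ⇐ ni) (isSourceType-self rep ni))) e)
      where
        open TypeCount (fromType T)
        twice : ∀ {a b} → a ≡ true → (a ∧ not b) ≡ false → b ≡ true
        twice {b = true} _ _ = refl
        twice {b = false} refl ()
    ... | v , w , v≢w , a , b with v ≟ᶠ i | TypeCount.counted⇒ (fromType T) v a | TypeCount.counted⇒ (fromType T) w b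
    ...   | no v≢i | ev , sv | _ = v , v≢i , ev , isSourceType⇒ rep sv
    ...   | yes refl | _ | ew , sw = w , (λ e → v≢w (sym e)) , ew , isSourceType⇒ rep sw

    coveredᵇ : Source k → Count → Vec Bool k → Vec Bool k → Bool
    coveredᵇ src c A A' = allF (lookup A) ∧ coveredOf (passSummary src c A A')

    covered⇒ : ∀ {src c A A' r i} → Represents src i → c ≡ sourceCount src → ReachedSet (suc r) i A → ReachedSet r i A' →
               coveredᵇ src c A A' ≡ true → ∀ u → Within (suc r) i u
    covered⇒ {src} {c} {A} {A'} {r} {i} rep refl rA rA' e u with ∧-true (allF (lookup A)) _ e
    ... | allA , allV with inCoverᵇ u in eu | covered-foldF⇒ _ allV u
    ...   | true | _ with inCoverᵇ⇒ eu
    ...     | j , refl = proj₁ (rA j) (allF-true _ allA j)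
    covered⇒ {src} {c} {A} {A'} {r} {i} rep refl rA rA' e u | allA , allV | false | cu
      with ∨-true (isSourceType src (typeOf u) ∧ exactlyOne c) _ cu
    ... | inj₂ m = meets⇒ {A' = A'} rA' m
    ... | inj₁ s with ∧-true (isSourceType src (typeOf u)) _ s
    ...   | s₁ , s₂ = subst (Within (suc r) i) (sym (count-unique rep s₂ u eu s₁)) Within-refl

    covered⇐ : ∀ {src c A A' r i} → Represents src i → c ≡ sourceCount src → ReachedSet (suc r) i A → ReachedSet r i A' →
               (∀ u → Within (suc r) i u) → coveredᵇ src c A A' ≡ true
    covered⇐ {src} {c} {A} {A'} {r} {i} rep refl rA rA' all =
      ∧-intro (allF-intro (lookup A) (λ j → proj₂ (rA j) (all (lookup xs j)))) (covered-foldF⇐ _ coveredAt)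
      where
        coveredAt : ∀ v → coveredOf (contrib src c A A' v (typeOf v)) ≡ true
        coveredAt v with inCoverᵇ v in ev
        ... | true = refl
        ... | false with Within-last (all v)
        ...   | inj₂ (y , wy , ey) = ∨-introʳ (isSourceType src (typeOf v) ∧ exactlyOne c) (meets⇐ {A' = A'} rA' (notInCoverᵇ⇒ ev) wy ey)
        ...   | inj₁ refl with exactlyOne c in eo
        ...     | true = ∨-introˡ (∧-intro (isSourceType-self rep (notInCoverᵇ⇒ ev)) refl)
        ...     | false with count-twin rep (notInCoverᵇ⇒ ev) eo
        ...       | w , w≢i , ew , tw with Within-last (all w)
        ...         | inj₁ i≡w = contradiction (sym i≡w) w≢i
        ...         | inj₂ (y , wy , ey) =
                      ∨-introʳ (isSourceType src (typeOf v) ∧ false) (subst (λ T → meetsᵇ T A' ≡ true) tw (meets⇐ {A' = A'} rA' (notInCoverᵇ⇒ ew) wy ey))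

    -- Every vertex reachable from i is within distance 2k + 1: within every two
    -- further layers a new cover vertex must be reached, until the search stalls.
    module Stabilisation (i : Fin n) where
      Stalled : ℕ → Set
      Stalled b = ∀ j → Within (suc (suc b)) i (lookup xs j) → Within b i (lookup xs j)

      stalled-step : ∀ b → Stalled b → ∀ t → Within (suc (suc (suc b))) i t → Within (suc (suc b)) i t
      stalled-step b hb t w with Within-last w
      ... | inj₁ eq = subst (Within _ i) eq Within-refl
      ... | inj₂ (v , wv , e) with inCoverᵇ v in ev
      ...   | true with inCoverᵇ⇒ ev
      ...     | j , refl = Within-mono (n≤1+n _) (Within-last⁻ (inj₂ (lookup xs j , hb j wv , e)))
      stalled-step b hb t w | inj₂ (v , wv , e) | false with Within-last wv
      ...   | inj₁ refl = Within-last⁻ (inj₂ (i , Within-refl , e))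
      ...   | inj₂ (y , wy , ey) with cover y v ey
      ...     | inj₂ p = contradiction p (notInCoverᵇ⇒ ev)
      ...     | inj₁ (j , refl) =
                Within-last⁻ (inj₂ (v , Within-last⁻ (inj₂ (lookup xs j , hb j (Within-mono (n≤1+n _) wy) , ey)) , e))

      stalled-suc : ∀ b → Stalled b → Stalled (suc b)
      stalled-suc b hb j w = Within-mono (n≤1+n _) (hb j (stalled-step b hb _ w))

      stalled-forever : ∀ m b → Stalled b → ∀ t → Within (m + suc (suc b)) i t → Within (suc (suc b)) i t
      stalled-forever zero b hb t w = w
      stalled-forever (suc m) b hb t w =
        stalled-step b hb t (stalled-forever m (suc b) (stalled-suc b hb) t (subst (λ z → Within z i t) (sym (+-suc m (suc (suc b)))) w))

      reachedCover : ℕ → Subset k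
      reachedCover b = tabulate (λ j → does (Within? b i (lookup xs j)))

      ∈-reachedCover⇒ : ∀ {b j} → j ∈ reachedCover b → Within b i (lookup xs j)
      ∈-reachedCover⇒ {b} {j} m = does-true (Within? b i (lookup xs j)) (trans (sym (lookup∘tabulate _ j)) ([]=⇒lookup m))

      ∈-reachedCover⇐ : ∀ {b j} → Within b i (lookup xs j) → j ∈ reachedCover b
      ∈-reachedCover⇐ {b} {j} w = lookup⇒[]= j _ (trans (lookup∘tabulate _ j) (dec-true (Within? b i (lookup xs j)) w))

      reachedCover-grows : ∀ b → ¬ Stalled b → reachedCover b ⊂ reachedCover (suc (suc b))
      reachedCover-grows b ns =
        (λ m → ∈-reachedCover⇐ (Within-mono (≤-trans (n≤1+n _) (n≤1+n _)) (∈-reachedCover⇒ m))) ,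
        j , ∈-reachedCover⇐ near , λ m → far (∈-reachedCover⇒ m)
        where
          Step : Fin k → Set
          Step j = Within (suc (suc b)) i (lookup xs j) → Within b i (lookup xs j)
          witness : Σ (Fin k) λ j → ¬ Step j
          witness = ¬∀⟶∃¬ k Step (λ j → Within? _ i (lookup xs j) →-dec Within? b i (lookup xs j)) ns
          j = proj₁ witness
          far : ¬ Within b i (lookup xs j)
          far w = proj₂ witness (λ _ → w)
          near : Within (suc (suc b)) i (lookup xs j)
          near = decidable-stable (Within? _ i (lookup xs j)) (λ nw → proj₂ witness (λ w → contradiction w nw))

      stall-or-grow : ∀ m → (Σ ℕ λ m' → m' < m × Stalled (m' + m')) ⊎ (m ≤ ∣ reachedCover (m + m) ∣)
      stall-or-grow zero = inj₂ Data.Nat.z≤n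
      stall-or-grow (suc m) with stall-or-grow m
      ... | inj₁ (m' , lt , st) = inj₁ (m' , ≤-trans lt (n≤1+n _) , st)
      ... | inj₂ le with all? (λ j → Within? _ i (lookup xs j) →-dec Within? (m + m) i (lookup xs j))
      ...   | yes st = inj₁ (m , ≤-refl , st)
      ...   | no ns = inj₂ (≤-trans (s≤s le) (subst (λ b → suc ∣ reachedCover (m + m) ∣ ≤ ∣ reachedCover b ∣)
                                                   (sym (cong suc (+-suc m m)))
                                                   (p⊂q⇒∣p∣<∣q∣ (reachedCover-grows (m + m) ns))))

      eccentricity-bound : ∀ t → Reachable G i t → Within (suc (suc (k + k))) i t
      eccentricity-bound t (ℓ , w) with stall-or-grow (suc k)
      ... | inj₂ le = contradiction (≤-<-trans (∣p∣≤n (reachedCover (suc k + suc k))) le) (<-irrefl refl)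
      ... | inj₁ (m' , s≤s m'≤k , st) =
        Within-mono (s≤s (s≤s (+-mono-≤ m'≤k m'≤k)))
          (stalled-forever ℓ (m' + m') st t
            (ℓ , subst (ℓ <_) (sym (+-suc ℓ (suc (m' + m')))) (s≤s (m≤m+n ℓ (suc (m' + m')))) , w))



module Schedule where

  open Monoids
  open BooleanTests
  open Contributions
  open SummaryFolds
  open import Data.Bool using (Bool; true; false; _∧_; not; if_then_else_)
  open import Data.Nat using (ℕ; zero; suc; _+_; _≤ᵇ_)
  open import Data.Fin using (Fin; zero; suc; toℕ)
  open import Data.List using (List; []; _∷_; _++_; map; concatMap; allFin)
  open import Data.Vec using (Vec; []; _∷_; lookup)
  open import Data.Maybe using (Maybe; just; nothing)
  open import Data.Product using (_×_; _,_; proj₁)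

  maxEccentricity : ℕ → ℕ
  maxEccentricity k = suc (k + k)

  Round : ℕ → Set
  Round k = Fin (suc (maxEccentricity k))

  -- (count of the source's type, A, A', first round at which everything was reached)
  SearchState : ℕ → Set
  SearchState k = Count × Vec Bool k × Vec Bool k × Maybe (Round k)

  -- The second component is the largest eccentricity found so far; nothing is ∞.
  MachineData : ℕ → Set
  MachineData k = SearchState k × Maybe (Round k)

  data Instr (k : ℕ) : Set where
    countI : Source k → Instr k
    roundI : Source k → Round k → Instr k
    finishI : Source k → Instr k

  sourceOf : ∀ {k} → Instr k → Source k
  sourceOf (countI s) = s
  sourceOf (roundI s _) = s
  sourceOf (finishI s) = s

  maxF : ∀ {m} → Fin m → Fin m → Fin m
  maxF a b = if toℕ a ≤ᵇ toℕ b then b else a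

  maxM : ∀ {m} → Maybe (Fin m) → Maybe (Fin m) → Maybe (Fin m)
  maxM (just a) (just b) = just (maxF a b)
  maxM _ _ = nothing

  -- A type that no vertex has is not a source.
  skipsᵇ : ∀ {k} → Source k → Count → Bool
  skipsᵇ (fromCover _) c = false
  skipsᵇ (fromType _) c = not (proj₁ c)

  recordFirst : ∀ {k} → Round k → Bool → Maybe (Round k) → Maybe (Round k)
  recordFirst r b nothing = if b then just r else nothing
  recordFirst r b (just x) = just x

  allVecs : ∀ m → List (Vec Bool m)
  allVecs zero = [] ∷ []
  allVecs (suc m) = map (false ∷_) (allVecs m) ++ map (true ∷_) (allVecs m)

  sources : ∀ k → List (Source k)
  sources k = map fromCover (allFin k) ++ map fromType (allVecs k)

  block : ∀ {k} → Source k → List (Instr k)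
  block {k} src = countI src ∷ (map (roundI src) (allFin (suc (maxEccentricity k))) ++ finishI src ∷ [])

  schedule : ∀ k → List (Instr k)
  schedule k = concatMap block (sources k)

  -- Each instruction takes one pass; its effect depends on the data only through the
  -- Summary that the pass computes, which execute takes from an oracle.
  module Interpreter {n k : ℕ} (xs : Vec (Fin n) k) where
    open Contribution xs

    searchStep : Instr k → SearchState k → Summary k → SearchState k
    searchStep (countI src) q s = countOf s , initialReached src , zeros , nothing
    searchStep (roundI src r) (c , A , A' , f) s =
      c , orV A (reachedOf s) , A , recordFirst {k} r (allF (lookup A) ∧ coveredOf s) f
    searchStep (finishI src) q s = q

    bestStep : Instr k → SearchState k → Maybe (Round k) → Maybe (Round k)
    bestStep (finishI src) (c , _ , _ , f) b = if skipsᵇ src c then b else maxM b f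
    bestStep _ q b = b

    machineStep : Instr k → MachineData k → Summary k → MachineData k
    machineStep ins (q , b) s = searchStep ins q s , bestStep ins q b

    contribFor : Instr k → MachineData k → Fin n → Vec Bool k → Summary k
    contribFor ins ((c , A , A' , f) , b) = contrib (sourceOf ins) c A A'

    data0 : MachineData k
    data0 = (count0 , zeros , zeros , nothing) , just zero

    execute : (Instr k → MachineData k → Summary k) → MachineData k → List (Instr k) → MachineData k
    execute O d [] = d
    execute O d (x ∷ L) = execute O (machineStep x d (O x d)) L

    output : MachineData k → Maybe ℕ
    output (_ , b) = Data.Maybe.map toℕ b



module MaxFold where

  open Schedule using (maxF; maxM)
  open import Data.Bool using (Bool; true; false; if_then_else_)
  open import Data.Bool.Properties using (T-≡)
  open import Data.Nat using (ℕ; _≤_; _≤ᵇ_)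
  open import Data.Nat.Properties using (≤-refl; ≤-trans; ≤ᵇ⇒≤; ≤⇒≤ᵇ; ≤-total)
  open import Data.Fin using (Fin; toℕ)
  open import Data.List using (List; []; _∷_; foldl)
  open import Data.List.Membership.Propositional using (_∈_)
  open import Data.List.Relation.Unary.Any using (here; there)
  open import Data.Maybe using (Maybe; just; nothing)
  open import Data.Product using (Σ; _×_; _,_)
  open import Data.Sum using (_⊎_; inj₁; inj₂)
  open import Relation.Nullary using (contradiction)
  open import Function.Bundles using (Equivalence)
  open import Relation.Binary.PropositionalEquality using (_≡_; refl; sym; trans; cong)

  maxF-≥ˡ : ∀ {m} (a b : Fin m) → toℕ a ≤ toℕ (maxF a b)
  maxF-≥ˡ a b with toℕ a ≤ᵇ toℕ b in e
  ... | true = ≤ᵇ⇒≤ (toℕ a) (toℕ b) (Equivalence.from T-≡ e)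
  ... | false = ≤-refl

  maxF-≥ʳ : ∀ {m} (a b : Fin m) → toℕ b ≤ toℕ (maxF a b)
  maxF-≥ʳ a b with toℕ a ≤ᵇ toℕ b in e
  ... | true = ≤-refl
  ... | false with ≤-total (toℕ b) (toℕ a)
  ...   | inj₁ b≤a = b≤a
  ...   | inj₂ a≤b = contradiction (trans (sym e) (Equivalence.to T-≡ (≤⇒≤ᵇ a≤b))) (λ ())

  maxF-sel : ∀ {m} (a b : Fin m) → (maxF a b ≡ a) ⊎ (maxF a b ≡ b)
  maxF-sel a b with toℕ a ≤ᵇ toℕ b
  ... | true = inj₂ refl
  ... | false = inj₁ refl

  module Skipping {S : Set} {m : ℕ} (sk : S → Bool) (F : S → Maybe (Fin m)) where
    keepMax : Maybe (Fin m) → S → Maybe (Fin m)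
    keepMax b s = if sk s then b else maxM b (F s)

    Included : S → List S → Set
    Included s L = s ∈ L × sk s ≡ false

    fold-nothing⇒ : ∀ L b → foldl keepMax b L ≡ nothing → (b ≡ nothing) ⊎ (Σ S λ s → Included s L × F s ≡ nothing)
    fold-nothing⇒ [] b e = inj₁ e
    fold-nothing⇒ (s ∷ L) b e with fold-nothing⇒ L (keepMax b s) e
    ... | inj₂ (s' , (p , q) , r) = inj₂ (s' , (there p , q) , r)
    ... | inj₁ e' with sk s in es
    ...   | true = inj₁ e'
    ...   | false with b | F s in ef
    ...     | nothing | _ = inj₁ refl
    ...     | just x | nothing = inj₂ (s , (here refl , es) , ef)
    ...     | just x | just y with e'
    ...       | ()

    fold-just-start : ∀ L b D → foldl keepMax b L ≡ just D → Σ (Fin m) λ b0 → (b ≡ just b0) × toℕ b0 ≤ toℕ D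
    fold-just-start [] b D e = D , e , ≤-refl
    fold-just-start (s ∷ L) b D e with fold-just-start L (keepMax b s) D e
    ... | b1 , e1 , le1 with sk s
    ...   | true = b1 , e1 , le1
    ...   | false with b | F s
    ...     | just x | just y with e1
    ...       | refl = x , refl , ≤-trans (maxF-≥ˡ x y) le1
    fold-just-start (s ∷ L) b D e | b1 , () , le1 | false | nothing | _
    fold-just-start (s ∷ L) b D e | b1 , () , le1 | false | just x | nothing

    fold-just-bound : ∀ L b D → foldl keepMax b L ≡ just D → ∀ s → Included s L → Σ (Fin m) λ f → (F s ≡ just f) × toℕ f ≤ toℕ D
    fold-just-bound (s ∷ L) b D e .s (here refl , es) with fold-just-start L (keepMax b s) D e
    ... | b1 , e1 , le1 rewrite es with b | F s
    ...   | just x | just y with e1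
    ...     | refl = y , refl , ≤-trans (maxF-≥ʳ x y) le1
    fold-just-bound (s ∷ L) b D e .s (here refl , es) | b1 , () , le1 | nothing | _
    fold-just-bound (s ∷ L) b D e .s (here refl , es) | b1 , () , le1 | just x | nothing
    fold-just-bound (s' ∷ L) b D e s (there p , es) = fold-just-bound L (keepMax b s') D e s (p , es)

    fold-just-witness : ∀ L b D → foldl keepMax b L ≡ just D → (b ≡ just D) ⊎ (Σ S λ s → Included s L × F s ≡ just D)
    fold-just-witness [] b D e = inj₁ e
    fold-just-witness (s ∷ L) b D e with fold-just-witness L (keepMax b s) D e
    ... | inj₂ (s' , (p , q) , r) = inj₂ (s' , (there p , q) , r)
    ... | inj₁ e' with sk s in es
    ...   | true = inj₁ e'
    ...   | false with b | F s in ef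
    ...     | just x | just y with e' | maxF-sel x y
    ...       | refl | inj₁ eq = inj₁ (cong just (sym eq))
    ...       | refl | inj₂ eq = inj₂ (s , (here refl , es) , trans ef (cong just (sym eq)))
    fold-just-witness (s ∷ L) b D e | inj₁ () | false | nothing | _
    fold-just-witness (s ∷ L) b D e | inj₁ () | false | just x | nothing


module ScheduleCorrect where

  open import Defs hiding (sym)
  open Monoids
  open BooleanTests
  open Contributions
  open SummaryFolds
  open Walks
  open LayerSearch
  open Schedule

  open import Data.Bool using (Bool; true; false; not)
  open import Data.Nat using (ℕ; zero; suc; _+_; _≤_; _<_; z≤n; s≤s)
  open import Data.Nat.Properties using (≤-refl; n≤1+n; ≤-trans; +-suc; +-identityʳ; m≤n⇒m<n∨m≡n; ≤-pred)
  open import Data.Fin using (Fin; zero; suc; toℕ)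
  open import Data.List using (List; []; _∷_; _++_; map; concatMap; allFin; foldl; tabulate)
  open import Data.Vec as Vec using (Vec; lookup)
  open import Data.List.Membership.Propositional using (_∈_)
  open import Data.List.Membership.Propositional.Properties using (∈-++⁺ˡ; ∈-++⁺ʳ; ∈-map⁺; ∈-allFin)
  open import Data.List.Relation.Unary.Any using (here)
  open import Data.Fin.Properties using (¬∀⟶∃¬)
  open import Data.Maybe using (Maybe; just; nothing)
  open import Data.Product using (Σ; _×_; _,_; proj₁; proj₂)
  open import Data.Sum using (_⊎_; inj₁; inj₂)
  open import Relation.Nullary using (¬_; contradiction)
  open import Relation.Binary.PropositionalEquality using (_≡_; refl; sym; trans; subst)

  allVecs-complete : ∀ {m} (T : Vec Bool m) → T ∈ allVecs m
  allVecs-complete {zero} Vec.[] = here refl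
  allVecs-complete {suc m} (false Vec.∷ T) = ∈-++⁺ˡ (∈-map⁺ (false Vec.∷_) (allVecs-complete T))
  allVecs-complete {suc m} (true Vec.∷ T) =
    ∈-++⁺ʳ (map (false Vec.∷_) (allVecs m)) (∈-map⁺ (true Vec.∷_) (allVecs-complete T))

  module Diameter {n k : ℕ} (G : Graph n) (xs : Vec (Fin n) k)
    (cover : ∀ u v → adj G u v ≡ true → InCover xs u ⊎ InCover xs v) where
    open Contribution xs
    open BoundedWalks G
    open Layers G xs cover
    open Interpreter xs

    exactSummary : Instr k → MachineData k → Summary k
    exactSummary ins ((c , A , A' , f) , b) = passSummary (sourceOf ins) c A A'

    execute-++ : ∀ O d L₁ L₂ → execute O d (L₁ ++ L₂) ≡ execute O (execute O d L₁) L₂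
    execute-++ O d [] L₂ = refl
    execute-++ O d (x ∷ L₁) L₂ = execute-++ O (machineStep x d (O x d)) L₁ L₂

    round : Source k → SearchState k → Round k → SearchState k
    round src (c , A , A' , f) r = searchStep (roundI src r) (c , A , A' , f) (passSummary src c A A')

    rounds : Source k → SearchState k → List (Round k) → SearchState k
    rounds src q [] = q
    rounds src q (r ∷ L) = rounds src (round src q r) L

    execute-rounds : ∀ src q b L → execute exactSummary (q , b) (map (roundI src) L) ≡ (rounds src q L , b)
    execute-rounds src q b [] = refl
    execute-rounds src (c , A , A' , f) b (r ∷ L) = execute-rounds src _ b L

    rounds-count : ∀ src q L → proj₁ (rounds src q L) ≡ proj₁ q
    rounds-count src q [] = refl
    rounds-count src (c , A , A' , f) (r ∷ L) = rounds-count src _ L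

    Covers : Fin n → ℕ → Set
    Covers i r = ∀ u → Within (suc r) i u

    Eccentricity : Fin n → ℕ → Set
    Eccentricity i x = Covers i x × (∀ r → r < x → ¬ Covers i r)

    FoundInv : Fin n → ℕ → Maybe (Round k) → Set
    FoundInv i r nothing = ∀ r' → r' < r → ¬ Covers i r'
    FoundInv i r (just x) = toℕ x < r × Eccentricity i (toℕ x)

    RoundInv : Source k → Fin n → ℕ → SearchState k → Set
    RoundInv src i r (c , A , A' , f) = c ≡ sourceCount src × ReachedSet (suc r) i A × ReachedSet r i A' × FoundInv i r f

    round-inv : ∀ {src i} → Represents src i → ∀ r q (r' : Round k) → toℕ r' ≡ r →
                RoundInv src i r q → RoundInv src i (suc r) (round src q r')
    round-inv {src} {i} rep r (c , A , A' , nothing) r' refl (ce , rA , rA' , none) =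
      ce , ReachedSet-step {c = c} {A = A} {A' = A'} rep rA rA' , rA , found
      where
        found : FoundInv i (suc r) (recordFirst {k} r' (coveredᵇ src c A A') nothing)
        found with coveredᵇ src c A A' in ec
        ... | true = ≤-refl , covered⇒ {A = A} {A' = A'} rep ce rA rA' ec , none
        ... | false = λ r'' lt cv → earlier r'' (m≤n⇒m<n∨m≡n (≤-pred lt)) cv
          where
            earlier : ∀ r'' → (r'' < r) ⊎ (r'' ≡ r) → ¬ Covers i r''
            earlier r'' (inj₁ lt) = none r'' lt
            earlier r'' (inj₂ refl) cv = contradiction (trans (sym (covered⇐ {A = A} {A' = A'} rep ce rA rA' cv)) ec) (λ ())
    round-inv {src} {i} rep r (c , A , A' , just x) r' er (ce , rA , rA' , (x<r , ecc)) =
      ce , ReachedSet-step {c = c} {A = A} {A' = A'} rep rA rA' , rA , (≤-trans x<r (n≤1+n r) , ecc)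

    rounds-inv : ∀ {src i} → Represents src i → ∀ m (g : Fin m → Round k) r q → (∀ j → toℕ (g j) ≡ r + toℕ j) →
                 RoundInv src i r q → RoundInv src i (r + m) (rounds src q (tabulate g))
    rounds-inv {src} {i} rep zero g r q eg inv = subst (λ z → RoundInv src i z q) (sym (+-identityʳ r)) inv
    rounds-inv {src} {i} rep (suc m) g r q eg inv =
      subst (λ z → RoundInv src i z (rounds src (round src q (g zero)) (tabulate (λ j → g (suc j))))) (sym (+-suc r m))
        (rounds-inv rep m (λ j → g (suc j)) (suc r) (round src q (g zero))
          (λ j → trans (eg (suc j)) (+-suc r (toℕ j)))
          (round-inv rep r q (g zero) (trans (eg zero) (+-identityʳ r)) inv))

    start : Source k → SearchState k
    start src = sourceCount src , initialReached src , zeros , nothing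

    allRounds : List (Round k)
    allRounds = allFin (suc (maxEccentricity k))

    eccentricityFound : Source k → Maybe (Round k)
    eccentricityFound src = proj₂ (proj₂ (proj₂ (rounds src (start src) allRounds)))

    eccentricityFound-correct : ∀ {src i} → Represents src i → FoundInv i (suc (maxEccentricity k)) (eccentricityFound src)
    eccentricityFound-correct {src} {i} rep
      with rounds src (start src) allRounds
         | rounds-inv rep (suc (maxEccentricity k)) (λ j → j) 0 (start src) (λ j → refl)
             (refl , ReachedSet-initial rep , ReachedSet-0 , (λ r' ()))
    ... | (c , A , A' , f) | (_ , _ , _ , found) = found

    skipped : Source k → Bool
    skipped src = skipsᵇ src (sourceCount src)

    open MaxFold.Skipping skipped eccentricityFound public

    block-result : ∀ (d : MachineData k) src → proj₂ (execute exactSummary d (block src)) ≡ keepMax (proj₂ d) src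
    block-result ((c , A , A' , f) , b) src
      rewrite execute-++ exactSummary ((countOf (passSummary src c A A') , initialReached src , zeros , nothing) , b)
                (map (roundI src) allRounds) (finishI src ∷ [])
            | execute-rounds src (countOf (passSummary src c A A') , initialReached src , zeros , nothing) b allRounds
            | count-independent src c A A'
            | rounds-count src (start src) allRounds = refl

    blocks-result : ∀ L (d : MachineData k) → proj₂ (execute exactSummary d (concatMap block L)) ≡ foldl keepMax (proj₂ d) L
    blocks-result [] d = refl
    blocks-result (src ∷ L) d rewrite execute-++ exactSummary d (block src) (concatMap block L)
      | blocks-result L (execute exactSummary d (block src)) | block-result d src = refl

    source-of : ∀ s → Σ (Source k) λ src → Included src (sources k) × Represents src s
    source-of s with inCoverᵇ s in e
    ... | true with inCoverᵇ⇒ e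
    ...   | j , p = fromCover j , (∈-++⁺ˡ (∈-map⁺ fromCover (∈-allFin j)) , refl) , viaCover j p
    source-of s | false =
      fromType (typeOf s) ,
      (∈-++⁺ʳ (map fromCover (allFin k)) (∈-map⁺ fromType (allVecs-complete (typeOf s))) , notSkipped) , rep
      where
        rep : Represents (fromType (typeOf s)) s
        rep = viaType (typeOf s) (notInCoverᵇ⇒ e) refl
        open TypeCount (fromType (typeOf s))
        notSkipped : skipped (fromType (typeOf s)) ≡ false
        notSkipped rewrite atLeastOne-foldF⇐ g s (counted⇐ s e (isSourceType-self rep (notInCoverᵇ⇒ e))) = refl

    included-represents : ∀ src → skipped src ≡ false → Σ (Fin n) λ i → Represents src i
    included-represents (fromCover j) e = lookup xs j , viaCover j refl
    included-represents (fromType T) e with atLeastOne-foldF⇒ g (not-false (proj₁ (sourceCount (fromType T))) e)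
      where
        open TypeCount (fromType T)
        not-false : ∀ b → not b ≡ false → b ≡ true
        not-false true _ = refl
    ... | v , p = v , viaType T (notInCoverᵇ⇒ (proj₁ counted)) (eqV-true (proj₂ counted))
      where counted = TypeCount.counted⇒ (fromType T) v p

    not-covers : ∀ i r → ¬ Covers i r → Σ (Fin n) λ u → ¬ Within (suc r) i u
    not-covers i r nc = ¬∀⟶∃¬ n (λ u → Within (suc r) i u) (λ u → Within? (suc r) i u) nc

    eccentricity-attained : ∀ i x → Eccentricity i x → Σ (Fin n) λ s → Σ (Fin n) λ t → IsDist G s t x
    eccentricity-attained i zero _ = i , i , here , (λ _ _ → z≤n)
    eccentricity-attained i (suc x) (cv , minimal) with not-covers i x (minimal x ≤-refl)
    ... | u , far with distance-within (suc x) (cv u)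
    ...   | d , d≤ , (w , shortest) with m≤n⇒m<n∨m≡n d≤
    ...     | inj₂ refl = i , u , w , shortest
    ...     | inj₁ (s≤s d<) = contradiction (d , s≤s d< , w) far

    result : Maybe (Round k)
    result = foldl keepMax (just zero) (sources k)

    result-eq : proj₂ (execute exactSummary data0 (schedule k)) ≡ result
    result-eq = blocks-result (sources k) data0

    result-infinite : result ≡ nothing → Σ (Fin n) λ s → Σ (Fin n) λ t → ¬ Reachable G s t
    result-infinite ef with fold-nothing⇒ (sources k) (just zero) ef
    ... | inj₂ (src , (_ , sk) , fe) with included-represents src sk
    ...   | i , rep with not-covers i (maxEccentricity k)
                          (subst (FoundInv i _) fe (eccentricityFound-correct rep) (maxEccentricity k) ≤-refl)
    ...     | u , far = i , u , λ r → far (Stabilisation.eccentricity-bound i u r)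

    result-finite : ∀ (s₀ : Fin n) D → result ≡ just D → IsDiameter G (just (toℕ D))
    result-finite s₀ D ef = bounded , attained
      where
        bounded : ∀ s t → Σ ℕ λ d → d ≤ toℕ D × IsDist G s t d
        bounded s t with source-of s
        ... | src , inc , rep with fold-just-bound (sources k) (just zero) D ef src inc
        ...   | f , fe , f≤D with subst (FoundInv s _) fe (eccentricityFound-correct rep)
        ...     | _ , cv , _ with distance-within (toℕ f) (cv t)
        ...       | d , d≤f , isd = d , ≤-trans d≤f f≤D , isd
        attained : Σ (Fin n) λ s → Σ (Fin n) λ t → IsDist G s t (toℕ D)
        attained with fold-just-witness (sources k) (just zero) D ef
        ... | inj₁ refl = s₀ , s₀ , here , (λ _ _ → z≤n)
        ... | inj₂ (src , (_ , sk) , fe) with included-represents src sk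
        ...   | i , rep = eccentricity-attained i (toℕ D) (proj₂ (subst (FoundInv i _) fe (eccentricityFound-correct rep)))

    result-diameter : Fin n → IsDiameter G (Data.Maybe.map toℕ result)
    result-diameter s₀ with result in ef
    ... | nothing = result-infinite ef
    ... | just D = result-finite s₀ D ef



module CoverList where

  open import Data.Bool using (true; false)
  open import Data.Nat using (ℕ; zero; suc)
  open import Data.Fin using (Fin; zero; suc)
  open import Data.Fin.Subset using (Subset; _∈_; ∣_∣)
  open import Data.List using (List; []; _∷_; map; length)
  open import Data.List.Properties using (length-map)
  import Data.List.Membership.Propositional as List
  open import Data.List.Membership.Propositional.Properties using (∈-map⁺)
  open import Data.List.Relation.Unary.Any using (here; there)
  open import Data.Vec using (Vec; []; _∷_; lookup; here; there)
  open import Data.Product using (Σ; _,_)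
  open import Relation.Binary.PropositionalEquality using (_≡_; refl; trans; cong)

  members : ∀ {n} → Subset n → List (Fin n)
  members [] = []
  members (true ∷ p) = zero ∷ map suc (members p)
  members (false ∷ p) = map suc (members p)

  length-members : ∀ {n} (p : Subset n) → length (members p) ≡ ∣ p ∣
  length-members [] = refl
  length-members (true ∷ p) = cong suc (trans (length-map suc (members p)) (length-members p))
  length-members (false ∷ p) = trans (length-map suc (members p)) (length-members p)

  ∈-members : ∀ {n} (p : Subset n) {x} → x ∈ p → x List.∈ members p
  ∈-members (true ∷ p) here = here refl
  ∈-members (true ∷ p) (there m) = there (∈-map⁺ suc (∈-members p m))
  ∈-members (false ∷ p) (there m) = ∈-map⁺ suc (∈-members p m)

  padTo : ∀ {A : Set} (k : ℕ) → A → List A → Vec A k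
  padTo zero a l = []
  padTo (suc k) a [] = a ∷ padTo k a []
  padTo (suc k) a (x ∷ l) = x ∷ padTo k a l

  padTo-complete : ∀ {A : Set} {k} (a : A) (l : List A) → length l ≡ k → ∀ {x} → x List.∈ l →
                   Σ (Fin k) λ j → lookup (padTo k a l) j ≡ x
  padTo-complete a (x ∷ l) refl (here refl) = zero , refl
  padTo-complete a (x ∷ l) refl (there m) with padTo-complete a l refl m
  ... | j , e = suc j , e

  coverVector : ∀ {n} (k : ℕ) → Fin n → Subset n → Vec (Fin n) k
  coverVector k a X = padTo k a (members X)

  coverVector-complete : ∀ {n k} (a : Fin n) (X : Subset n) → ∣ X ∣ ≡ k → ∀ {u} → u ∈ X →
                         Σ (Fin k) λ j → lookup (coverVector k a X) j ≡ u
  coverVector-complete a X e m = padTo-complete a (members X) (trans (length-members X) e) (∈-members X m)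



module StreamFolds where

  open import Defs hiding (sym)
  open Monoids
  open BooleanTests
  open Contributions
  open import Data.Bool using (Bool; true; _∨_; T)
  open import Data.Bool.Properties using (T?)
  open import Data.Nat using (ℕ)
  open import Data.Fin using (Fin)
  open import Data.List using (List; []; _∷_; map; concatMap; foldl; allFin)
  open import Data.List.Properties using (foldl-++)
  open import Data.List.Relation.Binary.Permutation.Propositional using (_↭_; ↭-sym)
  open import Data.List.Relation.Binary.Permutation.Propositional.Properties using (∈-resp-↭)
  import Data.List.Membership.Propositional as List
  open import Data.List.Membership.Propositional.Properties using (∈-filter⁺; ∈-filter⁻; ∈-allFin)
  open import Data.List.Relation.Unary.Any using (here; there)
  open import Data.Vec using (Vec; lookup)
  open import Data.Vec.Properties using (lookup-map)
  open import Data.Maybe using (Maybe; just; nothing)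
  open import Data.Product using (_×_; _,_)
  open import Data.Sum using (_⊎_; inj₁; inj₂)
  open import Relation.Nullary using (contradiction)
  open import Relation.Binary.PropositionalEquality using (_≡_; refl; sym; trans; cong; subst)

  module TypeAccumulation {n k : ℕ} (xs : Vec (Fin n) k) where
    open Contribution xs

    accum : List (Fin n) → Vec Bool k → Vec Bool k
    accum ℓ T = foldl (λ T u → markNeighbour u T) T ℓ

    lookup-markNeighbour : ∀ u T j → lookup (markNeighbour u T) j ≡ (lookup T j ∨ eqF (lookup xs j) u)
    lookup-markNeighbour u T j = trans (lookup-orV T _ j) (cong (lookup T j ∨_) (lookup-map j (λ x → eqF x u) xs))

    accum⇒ : ∀ ℓ T j → lookup (accum ℓ T) j ≡ true → (lookup T j ≡ true) ⊎ (lookup xs j List.∈ ℓ)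
    accum⇒ [] T j e = inj₁ e
    accum⇒ (u ∷ ℓ) T j e with accum⇒ ℓ (markNeighbour u T) j e
    ... | inj₂ m = inj₂ (there m)
    ... | inj₁ p with ∨-true (lookup T j) _ (trans (sym (lookup-markNeighbour u T j)) p)
    ...   | inj₁ q = inj₁ q
    ...   | inj₂ q = inj₂ (here (eqF-true q))

    accum-mono : ∀ ℓ T j → lookup T j ≡ true → lookup (accum ℓ T) j ≡ true
    accum-mono [] T j e = e
    accum-mono (u ∷ ℓ) T j e = accum-mono ℓ (markNeighbour u T) j (trans (lookup-markNeighbour u T j) (∨-introˡ e))

    accum⇐ : ∀ ℓ T j → lookup xs j List.∈ ℓ → lookup (accum ℓ T) j ≡ true
    accum⇐ (u ∷ ℓ) T j (here refl) =
      accum-mono ℓ (markNeighbour u T) j (trans (lookup-markNeighbour u T j) (∨-introʳ (lookup T j) (eqF-refl u)))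
    accum⇐ (u ∷ ℓ) T j (there m) = accum⇐ ℓ (markNeighbour u T) j m

    accum-nbrs : (G : Graph n) → ∀ v (ℓ : List (Fin n)) → ℓ ↭ nbrs G v → accum ℓ zeros ≡ Data.Vec.map (adj G v) xs
    accum-nbrs G v ℓ p = vec-ext _ _ λ j → trans (bool-ext (fwd j) (bwd j)) (sym (lookup-map j (adj G v) xs))
      where
        fwd : ∀ j → lookup (accum ℓ zeros) j ≡ true → adj G v (lookup xs j) ≡ true
        fwd j e with accum⇒ ℓ zeros j e
        ... | inj₁ z = contradiction (trans (sym z) (lookup-zeros j)) (λ ())
        ... | inj₂ m with ∈-filter⁻ (λ u → T? (adj G v u)) {xs = allFin n} (∈-resp-↭ p m)
        ...   | _ , t with adj G v (lookup xs j)
        ...     | true = refl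
        bwd : ∀ j → adj G v (lookup xs j) ≡ true → lookup (accum ℓ zeros) j ≡ true
        bwd j e = accum⇐ ℓ zeros j
                    (∈-resp-↭ (↭-sym p) (∈-filter⁺ (λ u → T? (adj G v u)) (∈-allFin _) (subst T (sym e) _)))

  -- An AL stream lets one pass fold any g v (type of v) over the vertices: the current
  -- vertex and the cover vertices among its neighbours so far are kept pending until
  -- the next vertex token.
  Pending : ℕ → ℕ → Set
  Pending n k = Maybe (Fin n × Vec Bool k)

  module VertexBlocks {n k : ℕ} (xs : Vec (Fin n) k) (Mo : ComMonoid) where
    open ComMonoid Mo
    open ComMonoidOps Mo
    open Contribution xs
    open TypeAccumulation xs

    commit : (Fin n → Vec Bool k → Carrier) → Pending n k → Carrier
    commit g nothing = ε
    commit g (just (w , T)) = g w T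

    markPending : Fin n → Pending n k → Pending n k
    markPending u nothing = nothing
    markPending u (just (w , T)) = just (w , markNeighbour u T)

    readToken : (Fin n → Vec Bool k → Carrier) → Carrier × Pending n k → Token n → Carrier × Pending n k
    readToken g (a , p) (vtx v) = (a ⊕ commit g p) , just (v , zeros)
    readToken g (a , p) (edge v u) = a , markPending u p

    vertexBlock : (Fin n → List (Fin n)) → Fin n → List (Token n)
    vertexBlock nb v = vtx v ∷ map (edge v) (nb v)

    flush : (Fin n → Vec Bool k → Carrier) → Carrier × Pending n k → Carrier
    flush g (a , p) = a ⊕ commit g p

    read-edges : ∀ g a w T v ℓ → foldl (readToken g) (a , just (w , T)) (map (edge v) ℓ) ≡ (a , just (w , accum ℓ T))
    read-edges g a w T v [] = refl
    read-edges g a w T v (u ∷ ℓ) = read-edges g a w (markNeighbour u T) v ℓ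

    read-block : ∀ g nb (st : Carrier × Pending n k) v →
                 foldl (readToken g) st (vertexBlock nb v) ≡ (flush g st , just (v , accum (nb v) zeros))
    read-block g nb (a , p) v = read-edges g (a ⊕ commit g p) v zeros v (nb v)

    read-blocks : ∀ g nb σ (st : Carrier × Pending n k) →
                  flush g (foldl (readToken g) st (concatMap (vertexBlock nb) σ)) ≡ flush g st ⊕ fold (λ v → g v (accum (nb v) zeros)) σ
    read-blocks g nb [] st = sym (identityʳ _)
    read-blocks g nb (v ∷ σ) st
      rewrite foldl-++ (readToken g) st (vertexBlock nb v) (concatMap (vertexBlock nb) σ) | read-block g nb st v
            | read-blocks g nb σ (flush g st , just (v , accum (nb v) zeros)) = assoc _ _ _



module MultiPass where

  open import Defs hiding (sym)
  open Monoids
  open BooleanTests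
  open Contributions
  open LayerSearch
  open Schedule
  open StreamFolds
  open ScheduleCorrect
  open import Data.Bool using (Bool; true; if_then_else_)
  open import Data.Nat using (ℕ; zero; suc; _<_; _<?_; s≤s)
  open import Data.Nat.Properties using (+-suc; +-identityʳ; m≤m+n)
  open import Data.Fin using (Fin; zero; suc; toℕ; fromℕ<)
  open import Data.Fin.Properties using (toℕ-fromℕ<; _≟_)
  open import Data.List using (List; []; _∷_; _++_; map; concatMap; foldl; allFin; length)
  open import Data.List.Properties using (length-++; ++-assoc; foldl-++)
  open import Data.List.Relation.Binary.Permutation.Propositional using (_↭_; ↭-sym; ↭⇒↭ₛ)
  open import Data.List.Relation.Binary.Permutation.Setoid.Properties using (Unique-resp-↭)
  open import Data.List.Relation.Unary.All using (All; []; _∷_)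
  open import Data.List.Relation.Unary.AllPairs using (_∷_)
  open import Data.List.Relation.Unary.Unique.Propositional.Properties using (allFin⁺)
  open import Data.Vec using (Vec)
  open import Data.Maybe using (Maybe; just; nothing)
  open import Data.Product using (Σ; _×_; _,_; proj₂)
  open import Data.Sum using (_⊎_)
  open import Relation.Nullary using (¬_; yes; no; contradiction)
  open import Relation.Nullary.Decidable using (dec-false)
  open import Relation.Binary.PropositionalEquality using (_≡_; refl; sym; trans; cong; subst; setoid)

  lookupOr : ∀ {A : Set} → List A → ℕ → A → A
  lookupOr [] i a = a
  lookupOr (x ∷ l) zero a = x
  lookupOr (x ∷ l) (suc i) a = lookupOr l i a

  lookupOr-++ : ∀ {A : Set} (pre : List A) x L a → lookupOr (pre ++ x ∷ L) (length pre) a ≡ x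
  lookupOr-++ [] x L a = refl
  lookupOr-++ (y ∷ pre) x L a = lookupOr-++ pre x L a

  sucSat : ∀ {m} → Fin (suc m) → Fin (suc m)
  sucSat {m} i with suc (toℕ i) <? suc m
  ... | yes lt = fromℕ< lt
  ... | no _ = i

  toℕ-sucSat : ∀ {m} (i : Fin (suc m)) → toℕ i < m → toℕ (sucSat i) ≡ suc (toℕ i)
  toℕ-sucSat {m} i lt with suc (toℕ i) <? suc m
  ... | yes lt' = toℕ-fromℕ< lt'
  ... | no nlt = contradiction (s≤s lt) nlt

  passesOn : ∀ {A : Set} {n} → (A → Token n → A) → ℕ → A → List (Token n) → A
  passesOn f zero st s = st
  passesOn f (suc p) st s = passesOn f p (foldl f st s) s

  -- The state holds the cover, the first vertex of the stream (which marks the start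
  -- of every later pass), the program counter and data of the interpreter, and the
  -- summary of the current pass under construction.
  module Machine {n k : ℕ} where
    open VertexBlocks using (commit; markPending)

    len : ℕ
    len = length (schedule k)

    Program : Set
    Program = Fin (suc len) × MachineData k

    instrAt : Fin (suc len) → Instr k
    instrAt pc = lookupOr (schedule k) (toℕ pc) (finishI (fromType zeros))

    State : Set
    State = Vec (Fin n) k × Maybe (Fin n) × Program × Summary k × Pending n k

    module _ (xs : Vec (Fin n) k) where
      open Interpreter xs

      contribAt : Program → Fin n → Vec Bool k → Summary k
      contribAt (pc , d) = contribFor (instrAt pc) d

      advance : Program → Summary k → Program
      advance (pc , d) s = sucSat pc , machineStep (instrAt pc) d s

      passSoFar : Program → Summary k → Pending n k → Summary k
      passSoFar P a p = a ⊕M commit xs (summaryMonoid k) (contribAt P) p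

    readVertex : Vec (Fin n) k → Maybe (Fin n) → Program → Summary k → Pending n k → Fin n → State
    readVertex xs nothing P a p v = xs , just v , P , passSoFar xs P a p , just (v , zeros)
    readVertex xs (just f) P a p v =
      if eqF f v then (xs , just f , advance xs P (passSoFar xs P a p) , εS , just (v , zeros))
      else (xs , just f , P , passSoFar xs P a p , just (v , zeros))

    stepM : State → Token n → State
    stepM (xs , f , P , a , p) (edge v u) = xs , f , P , a , markPending xs (summaryMonoid k) u p
    stepM (xs , f , P , a , p) (vtx v) = readVertex xs f P a p v

    outM : State → Maybe ℕ
    outM (xs , f , P , a , p) = Interpreter.output xs (proj₂ (advance xs P (passSoFar xs P a p)))

    initM : Vec (Fin n) k → State
    initM xs = xs , nothing , (zero , Interpreter.data0 xs) , εS , nothing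

  module Run {n k : ℕ} (G : Graph n) (xs : Vec (Fin n) k)
    (cover : ∀ u v → adj G u v ≡ true → InCover xs u ⊎ InCover xs v)
    (σ₀ : Fin n) (rest : List (Fin n)) (σp : (σ₀ ∷ rest) ↭ allFin n)
    (nb : Fin n → List (Fin n)) (nbp : ∀ v → nb v ↭ nbrs G v) where
    open Layers G xs cover
    open Diameter G xs cover
    open Interpreter xs
    open VertexBlocks xs (summaryMonoid k)
    open TypeAccumulation xs
    open Machine {n} {k}
    open ComMonoidOps (summaryMonoid k)
    open ComMonoid (summaryMonoid k) using (assoc; identityˡ)

    σ : List (Fin n)
    σ = σ₀ ∷ rest

    afterFirst : List (Token n)
    afterFirst = map (edge σ₀) (nb σ₀) ++ concatMap (vertexBlock nb) rest

    s : List (Token n)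
    s = concatMap (vertexBlock nb) σ

    σ₀∉rest : All (λ v → ¬ σ₀ ≡ v) rest
    σ₀∉rest with Unique-resp-↭ (setoid (Fin n)) (↭⇒↭ₛ (↭-sym σp)) (allFin⁺ n)
    ... | σ₀∉ ∷ _ = σ₀∉

    exactAt : Program → Summary k
    exactAt (pc , d) = exactSummary (instrAt pc) d

    streamSummary : Program → Summary k
    streamSummary P = fold (λ v → contribAt xs P v (accum (nb v) zeros)) σ

    streamSummary≡exact : ∀ P → streamSummary P ≡ exactAt P
    streamSummary≡exact P@(pc , ((c , A , A' , f) , b)) =
      trans (fold-cong (λ v → cong (contribAt xs P v) (accum-nbrs G v (nb v) (nbp v))) σ)
            (trans (fold-↭ (λ v → contribAt xs P v (typeOf v)) σp) (fold-tabulate (λ v → contribAt xs P v (typeOf v)) (λ v → v)))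

    stateWith : Maybe (Fin n) → Program → Summary k × Pending n k → State
    stateWith f P (a , p) = xs , f , P , a , p

    read-edges-state : ∀ f P v (ℓ : List (Fin n)) st →
      foldl stepM (stateWith f P st) (map (edge v) ℓ) ≡ stateWith f P (foldl (readToken (contribAt xs P)) st (map (edge v) ℓ))
    read-edges-state f P v [] st = refl
    read-edges-state f P v (u ∷ ℓ) (a , p) = read-edges-state f P v ℓ (a , markPending u p)

    read-blocks-state : ∀ P (l : List (Fin n)) → All (λ v → ¬ σ₀ ≡ v) l → ∀ st →
      foldl stepM (stateWith (just σ₀) P st) (concatMap (vertexBlock nb) l)
        ≡ stateWith (just σ₀) P (foldl (readToken (contribAt xs P)) st (concatMap (vertexBlock nb) l))
    read-blocks-state P [] _ st = refl
    read-blocks-state P (v ∷ l) (σ₀≢v ∷ σ₀∉l) (a , p)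
      rewrite foldl-++ stepM (stateWith (just σ₀) P (a , p)) (vertexBlock nb v) (concatMap (vertexBlock nb) l)
            | foldl-++ (readToken (contribAt xs P)) (a , p) (vertexBlock nb v) (concatMap (vertexBlock nb) l)
            | dec-false (σ₀ ≟ v) σ₀≢v
            | read-edges-state (just σ₀) P v (nb v) (passSoFar xs P a p , just (v , zeros))
            = read-blocks-state P l σ₀∉l _

    after-first-vertex : ∀ P a₀ → Σ (Summary k × Pending n k) λ ap →
      (foldl stepM (stateWith (just σ₀) P (a₀ , just (σ₀ , zeros))) afterFirst ≡ stateWith (just σ₀) P ap)
      × flush (contribAt xs P) ap ≡ a₀ ⊕M streamSummary P
    after-first-vertex P a₀ = _ , reads , sums
      where
        reads : foldl stepM (stateWith (just σ₀) P (a₀ , just (σ₀ , zeros))) afterFirst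
                ≡ stateWith (just σ₀) P (foldl (readToken (contribAt xs P)) (a₀ , just (σ₀ , accum (nb σ₀) zeros)) (concatMap (vertexBlock nb) rest))
        reads rewrite foldl-++ stepM (stateWith (just σ₀) P (a₀ , just (σ₀ , zeros))) (map (edge σ₀) (nb σ₀)) (concatMap (vertexBlock nb) rest)
                    | read-edges-state (just σ₀) P σ₀ (nb σ₀) (a₀ , just (σ₀ , zeros))
                    | read-edges (contribAt xs P) a₀ σ₀ zeros σ₀ (nb σ₀) = read-blocks-state P rest σ₀∉rest _
        sums : flush (contribAt xs P) (foldl (readToken (contribAt xs P)) (a₀ , just (σ₀ , accum (nb σ₀) zeros)) (concatMap (vertexBlock nb) rest))
               ≡ a₀ ⊕M streamSummary P
        sums = trans (read-blocks (contribAt xs P) nb rest _) (assoc a₀ _ _)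

    -- The state at the end of a pass for P, up to the summary that the pass computed.
    Synced : Program → State → Set
    Synced P st = Σ (Summary k × Pending n k) λ ap → (st ≡ stateWith (just σ₀) P ap) × flush (contribAt xs P) ap ≡ exactAt P

    read-first-vertex : ∀ P a p → stepM (stateWith (just σ₀) P (a , p)) (vtx σ₀)
                                  ≡ stateWith (just σ₀) (advance xs P (passSoFar xs P a p)) (εS , just (σ₀ , zeros))
    read-first-vertex P a p rewrite eqF-refl σ₀ = refl

    start-of-pass : ∀ P a p → flush (contribAt xs P) (a , p) ≡ exactAt P →
                    foldl stepM (stateWith (just σ₀) P (a , p)) s
                      ≡ foldl stepM (stateWith (just σ₀) (advance xs P (exactAt P)) (εS , just (σ₀ , zeros))) afterFirst
    start-of-pass P a p ev =
      cong (λ st → foldl stepM st afterFirst)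
           (trans (read-first-vertex P a p) (cong (λ z → stateWith (just σ₀) (advance xs P z) (εS , just (σ₀ , zeros))) ev))

    flush-exact : ∀ P ap a₀ → a₀ ≡ εS → flush (contribAt xs P) ap ≡ a₀ ⊕M streamSummary P → flush (contribAt xs P) ap ≡ exactAt P
    flush-exact P ap a₀ refl sums = trans sums (trans (identityˡ (streamSummary P)) (streamSummary≡exact P))

    -- let rather than with: with-abstraction would normalise the fold over the stream.
    pass-synced : ∀ P st → Synced P st → Synced (advance xs P (exactAt P)) (foldl stepM st s)
    pass-synced P _ ((a , p) , refl , ev) =
      let (ap , reads , sums) = after-first-vertex (advance xs P (exactAt P)) εS
      in ap , trans (start-of-pass P a p ev) reads , flush-exact (advance xs P (exactAt P)) ap εS refl sums

    first-pass-synced : Synced (zero , data0) (foldl stepM (initM xs) s)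
    first-pass-synced =
      let (ap , reads , sums) = after-first-vertex (zero , data0) (εS ⊕M εS)
      in ap , reads , flush-exact (zero , data0) ap (εS ⊕M εS) (identityˡ εS) sums

    iterate : ℕ → Program → Program
    iterate zero P = P
    iterate (suc m) P = iterate m (advance xs P (exactAt P))

    iterate-suc : ∀ m P → iterate (suc m) P ≡ advance xs (iterate m P) (exactAt (iterate m P))
    iterate-suc zero P = refl
    iterate-suc (suc m) P = iterate-suc m _

    passes-synced : ∀ m P st → Synced P st → Synced (iterate m P) (passesOn stepM m st s)
    passes-synced zero P st sy = sy
    passes-synced (suc m) P st sy = passes-synced m _ _ (pass-synced P st sy)

    output-after : ∀ m → outM (passesOn stepM (suc m) (initM xs) s) ≡ output (proj₂ (iterate (suc m) (zero , data0)))
    output-after m = trans (output-synced _ _ (passes-synced m (zero , data0) _ first-pass-synced))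
                           (cong (λ P → output (proj₂ P)) (sym (iterate-suc m (zero , data0))))
      where
        output-synced : ∀ P st → Synced P st → outM st ≡ output (proj₂ (advance xs P (exactAt P)))
        output-synced P _ ((a , p) , refl , ev) = cong (λ z → output (proj₂ (advance xs P z))) ev

    iterate-schedule : ∀ pre L (pc : Fin (suc len)) d → schedule k ≡ pre ++ L → toℕ pc ≡ length pre →
                       proj₂ (iterate (length L) (pc , d)) ≡ execute exactSummary d L
    iterate-schedule pre [] pc d e ep = refl
    iterate-schedule pre (x ∷ L) pc d e ep =
      trans (cong (λ P → proj₂ (iterate (length L) P)) advance-eq)
            (iterate-schedule (pre ++ x ∷ []) L (sucSat pc) _ (trans e (sym (++-assoc pre (x ∷ []) L))) pc'≡)
      where
        at-x : instrAt pc ≡ x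
        at-x rewrite e | ep = lookupOr-++ pre x L _
        advance-eq : advance xs (pc , d) (exactAt (pc , d)) ≡ (sucSat pc , machineStep x d (exactSummary x d))
        advance-eq rewrite at-x = refl
        pc<len : toℕ pc < len
        pc<len rewrite ep | e | length-++ pre {x ∷ L} =
          subst (length pre <_) (sym (+-suc (length pre) (length L))) (s≤s (m≤m+n _ _))
        pc'≡ : toℕ (sucSat pc) ≡ length (pre ++ x ∷ [])
        pc'≡ rewrite toℕ-sucSat pc pc<len | ep | length-++ pre {x ∷ []} =
          trans (cong suc (sym (+-identityʳ _))) (sym (+-suc (length pre) 0))


module TypeTables where

  open Monoids
  open BooleanTests
  open Contributions
  open SummaryFolds
  open import Data.Bool using (Bool; true; false; _∨_; _∧_)
  open import Data.Bool.Properties using (∧-distribʳ-∨; ∧-distribˡ-∨; ∧-zeroʳ; ∧-assoc; ∧-comm)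
  open import Data.Nat using (ℕ; zero; suc)
  open import Data.Fin using (Fin; zero; suc)
  open import Data.List using ([]; _∷_)
  open import Data.Vec using (Vec; []; _∷_; lookup; zipWith; replicate)
  open import Data.Vec.Properties using (lookup-zipWith; lookup-replicate; map-∘; map-cong; map-const; map-replicate)
  open import Data.Product using (_×_; _,_)
  open import Relation.Binary.PropositionalEquality using (_≡_; refl; sym; trans; cong; cong₂)

  -- Table d assigns a Count to every vector in Vec Bool d (a binary trie).
  Table : ℕ → Set
  Table zero = Count
  Table (suc d) = Table d × Table d

  table0 : ∀ {d} → Table d
  table0 {zero} = count0
  table0 {suc d} = table0 , table0

  _⊕T_ : ∀ {d} → Table d → Table d → Table d
  _⊕T_ {zero} a b = a ⊕c b
  _⊕T_ {suc d} (a , b) (a' , b') = (a ⊕T a') , (b ⊕T b')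

  singleton : ∀ {d} → Vec Bool d → Table d
  singleton [] = true , false
  singleton (false ∷ T) = singleton T , table0
  singleton (true ∷ T) = table0 , singleton T

  ⊕T-assoc : ∀ {d} (a b c : Table d) → (a ⊕T b) ⊕T c ≡ a ⊕T (b ⊕T c)
  ⊕T-assoc {zero} a b c = ⊕c-assoc a b c
  ⊕T-assoc {suc d} (a , a') (b , b') (c , c') = cong₂ _,_ (⊕T-assoc a b c) (⊕T-assoc a' b' c')

  ⊕T-comm : ∀ {d} (a b : Table d) → a ⊕T b ≡ b ⊕T a
  ⊕T-comm {zero} a b = ⊕c-comm a b
  ⊕T-comm {suc d} (a , a') (b , b') = cong₂ _,_ (⊕T-comm a b) (⊕T-comm a' b')

  ⊕T-identityˡ : ∀ {d} (a : Table d) → table0 ⊕T a ≡ a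
  ⊕T-identityˡ {zero} a = ⊕c-identityˡ a
  ⊕T-identityˡ {suc d} (a , a') = cong₂ _,_ (⊕T-identityˡ a) (⊕T-identityˡ a')

  -- Row j records the neighbours in the cover of the j-th cover vertex.
  Rows : ℕ → Set
  Rows k = Vec (Vec Bool k) k

  rows0 : ∀ {k} → Rows k
  rows0 = replicate _ zeros

  _⊕R_ : ∀ {k m} → Vec (Vec Bool k) m → Vec (Vec Bool k) m → Vec (Vec Bool k) m
  _⊕R_ = zipWith orV

  ⊕R-assoc : ∀ {k m} (a b c : Vec (Vec Bool k) m) → (a ⊕R b) ⊕R c ≡ a ⊕R (b ⊕R c)
  ⊕R-assoc [] [] [] = refl
  ⊕R-assoc (x ∷ a) (y ∷ b) (z ∷ c) = cong₂ _∷_ (orV-assoc x y z) (⊕R-assoc a b c)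

  ⊕R-comm : ∀ {k m} (a b : Vec (Vec Bool k) m) → a ⊕R b ≡ b ⊕R a
  ⊕R-comm [] [] = refl
  ⊕R-comm (x ∷ a) (y ∷ b) = cong₂ _∷_ (orV-comm x y) (⊕R-comm a b)

  ⊕R-identityˡ : ∀ {k m} (a : Vec (Vec Bool k) m) → replicate m zeros ⊕R a ≡ a
  ⊕R-identityˡ [] = refl
  ⊕R-identityˡ (x ∷ a) = cong₂ _∷_ (orV-identityˡ x) (⊕R-identityˡ a)

  Sketch : ℕ → Set
  Sketch k = Table k × Rows k

  sketchMonoid : ℕ → ComMonoid
  sketchMonoid k = record
    { Carrier = Sketch k ; ε = table0 , rows0 ; _⊕_ = λ { (t , r) (t' , r') → (t ⊕T t') , (r ⊕R r') }
    ; assoc = λ { (t , r) (t' , r') (t'' , r'') → cong₂ _,_ (⊕T-assoc t t' t'') (⊕R-assoc r r' r'') }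
    ; comm = λ { (t , r) (t' , r') → cong₂ _,_ (⊕T-comm t t') (⊕R-comm r r') }
    ; identityˡ = λ { (t , r) → cong₂ _,_ (⊕T-identityˡ t) (⊕R-identityˡ r) }
    }

  mask-∨ : ∀ {m} a b (T : Vec Bool m) → orV (mask a T) (mask b T) ≡ mask (a ∨ b) T
  mask-∨ a b [] = refl
  mask-∨ a b (x ∷ T) = cong₂ _∷_ (sym (∧-distribʳ-∨ x a b)) (mask-∨ a b T)

  mask-orV : ∀ {m} b (x y : Vec Bool m) → mask b (orV x y) ≡ orV (mask b x) (mask b y)
  mask-orV b [] [] = refl
  mask-orV b (x ∷ xs) (y ∷ ys) = cong₂ _∷_ (∧-distribˡ-∨ b x y) (mask-orV b xs ys)

  mask-mask : ∀ {m} a b (T : Vec Bool m) → mask a (mask b T) ≡ mask (b ∧ a) T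
  mask-mask a b T = trans (sym (map-∘ (a ∧_) (b ∧_) T))
                          (map-cong (λ x → trans (sym (∧-assoc a b x)) (cong (_∧ x) (∧-comm a b))) T)

  mask-false : ∀ {m} (T : Vec Bool m) → mask false T ≡ zeros
  mask-false T = map-const T false

  mask-zeros : ∀ {m} b → mask b (zeros {m}) ≡ zeros
  mask-zeros {m} b = trans (map-replicate (b ∧_) false m) (cong (replicate m) (∧-zeroʳ b))

  module _ {k : ℕ} where
    open ComMonoidOps (summaryMonoid k)
    open ComMonoid (summaryMonoid k) using (assoc; comm; identityˡ)

    -- Because a ⊕M a ⊕M a ≡ a ⊕M a, the summary of a multiset of types depends only on
    -- the multiplicities capped at two, which is what a Table records.
    times : Count → Summary k → Summary k
    times (false , false) m = εS
    times (true , false) m = m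
    times (_ , true) m = m ⊕M m

    double-double : ∀ m → (m ⊕M m) ⊕M (m ⊕M m) ≡ m ⊕M m
    double-double m = trans (assoc m m (m ⊕M m)) (trans (cong (m ⊕M_) (⊕M-triple m)) (⊕M-triple m))

    double-single : ∀ m → (m ⊕M m) ⊕M m ≡ m ⊕M m
    double-single m = trans (comm (m ⊕M m) m) (⊕M-triple m)

    times-⊕ : ∀ c c' m → times (c ⊕c c') m ≡ times c m ⊕M times c' m
    times-⊕ (false , false) (false , false) m = sym (identityˡ _)
    times-⊕ (false , false) (false , true) m = sym (identityˡ _)
    times-⊕ (false , false) (true , false) m = sym (identityˡ _)
    times-⊕ (false , false) (true , true) m = sym (identityˡ _)
    times-⊕ (false , true) (false , false) m = sym (identityʳ _)
    times-⊕ (false , true) (false , true) m = sym (double-double m)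
    times-⊕ (false , true) (true , false) m = sym (double-single m)
    times-⊕ (false , true) (true , true) m = sym (double-double m)
    times-⊕ (true , false) (false , false) m = sym (identityʳ _)
    times-⊕ (true , false) (false , true) m = sym (⊕M-triple m)
    times-⊕ (true , false) (true , false) m = refl
    times-⊕ (true , false) (true , true) m = sym (⊕M-triple m)
    times-⊕ (true , true) (false , false) m = sym (identityʳ _)
    times-⊕ (true , true) (false , true) m = sym (double-double m)
    times-⊕ (true , true) (true , false) m = sym (double-single m)
    times-⊕ (true , true) (true , true) m = sym (double-double m)

    evalTable : ∀ {d} → (Vec Bool d → Summary k) → Table d → Summary k
    evalTable {zero} g c = times c (g [])
    evalTable {suc d} g (t₀ , t₁) = evalTable (λ T → g (false ∷ T)) t₀ ⊕M evalTable (λ T → g (true ∷ T)) t₁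

    evalTable-⊕ : ∀ {d} (g : Vec Bool d → Summary k) t t' → evalTable g (t ⊕T t') ≡ evalTable g t ⊕M evalTable g t'
    evalTable-⊕ {zero} g c c' = times-⊕ c c' (g [])
    evalTable-⊕ {suc d} g (t₀ , t₁) (t₀' , t₁') =
      trans (cong₂ _⊕M_ (evalTable-⊕ g₀ t₀ t₀') (evalTable-⊕ g₁ t₁ t₁'))
            (interchange (evalTable g₀ t₀) (evalTable g₀ t₀') (evalTable g₁ t₁) (evalTable g₁ t₁'))
      where
        g₀ g₁ : Vec Bool d → Summary k
        g₀ T = g (false ∷ T)
        g₁ T = g (true ∷ T)

    evalTable-ε : ∀ {d} (g : Vec Bool d → Summary k) → evalTable g table0 ≡ εS
    evalTable-ε {zero} g = refl
    evalTable-ε {suc d} g = trans (cong₂ _⊕M_ (evalTable-ε (λ T → g (false ∷ T))) (evalTable-ε (λ T → g (true ∷ T)))) (identityˡ εS)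

    evalTable-singleton : ∀ {d} (g : Vec Bool d → Summary k) T → evalTable g (singleton T) ≡ g T
    evalTable-singleton g [] = refl
    evalTable-singleton {suc d} g (false ∷ T) =
      trans (cong₂ _⊕M_ (evalTable-singleton (λ T → g (false ∷ T)) T) (evalTable-ε {d} (λ T → g (true ∷ T)))) (identityʳ _)
    evalTable-singleton {suc d} g (true ∷ T) =
      trans (cong₂ _⊕M_ (evalTable-ε {d} (λ T → g (false ∷ T))) (evalTable-singleton (λ T → g (true ∷ T)) T)) (identityˡ _)

    rowContrib : Vec Bool k → Rows k → Fin k → Summary k
    rowContrib A rows j = count0 , mask (lookup A j) (lookup rows j) , true

    evalRows : Vec Bool k → Rows k → Summary k
    evalRows A rows = foldF (rowContrib A rows)

    evalRows-⊕ : ∀ A r r' → evalRows A (r ⊕R r') ≡ evalRows A r ⊕M evalRows A r'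
    evalRows-⊕ A r r' =
      trans (foldF-cong (λ j → cong (λ M → count0 , M , true)
                                    (trans (cong (mask (lookup A j)) (lookup-zipWith orV j r r')) (mask-orV (lookup A j) _ _))))
            (foldF-⊕ (rowContrib A r) (rowContrib A r'))

    evalRows-ε : ∀ A → evalRows A rows0 ≡ εS
    evalRows-ε A =
      trans (foldF-cong (λ j → cong (λ M → count0 , M , true)
                                    (trans (cong (mask (lookup A j)) (lookup-replicate j zeros)) (mask-zeros _))))
            (foldF-ε {k})

    foldF-mask : ∀ {m} (b : Fin m → Bool) T → foldF (λ j → count0 , mask (b j) T , true) ≡ (count0 , mask (anyF b) T , true)
    foldF-mask {zero} b T = cong (λ M → count0 , M , true) (sym (mask-false T))
    foldF-mask {suc m} b T =
      trans (cong (λ s → (count0 , mask (b zero) T , true) ⊕M s) (foldF-mask (λ j → b (suc j)) T))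
            (cong (λ M → count0 , M , true) (mask-∨ (b zero) _ T))


module OnePass where

  open import Defs hiding (sym)
  open Monoids
  open BooleanTests
  open Contributions
  open LayerSearch
  open Schedule
  open ScheduleCorrect
  open StreamFolds
  open TypeTables
  open import Data.Bool using (Bool; true; false; _∧_; if_then_else_)
  open import Data.Nat using (ℕ)
  open import Data.Fin using (Fin)
  open import Data.List using (List; []; _∷_; foldl; concatMap; allFin)
  open import Data.List.Relation.Binary.Permutation.Propositional using (_↭_)
  open import Data.Vec using (Vec; lookup; map)
  open import Data.Vec.Properties using (lookup-map)
  open import Data.Maybe using (Maybe; nothing)
  open import Data.Product using (_×_; _,_)
  open import Data.Sum using (_⊎_)
  open import Relation.Binary.PropositionalEquality using (_≡_; refl; trans; cong; cong₂)

  -- The sketch of a stream: the Table of types of the vertices outside the cover and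
  -- the Rows of the cover vertices. Every pass summary can be decoded from it.
  module Sketching {n k : ℕ} (xs : Vec (Fin n) k) where
    open Contribution xs
    open ComMonoidOps (summaryMonoid k)
    open ComMonoid (summaryMonoid k) using (identityˡ)
    private module S = ComMonoid (sketchMonoid k)

    rowsFor : Fin n → Vec Bool k → Rows k
    rowsFor v T = map (λ x → mask (eqF x v) T) xs

    sketchOf : Fin n → Vec Bool k → Sketch k
    sketchOf v T = if inCoverᵇ v then (table0 , rowsFor v T) else (singleton T , rows0)

    decode : Source k → Count → Vec Bool k → Vec Bool k → Sketch k → Summary k
    decode src c A A' (t , rows) = evalTable (contribIndependent src c A') t ⊕M evalRows A rows

    decode-⊕ : ∀ src c A A' x y → decode src c A A' (x S.⊕ y) ≡ decode src c A A' x ⊕M decode src c A A' y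
    decode-⊕ src c A A' (t , r) (t' , r') =
      trans (cong₂ _⊕M_ (evalTable-⊕ g t t') (evalRows-⊕ A r r'))
            (interchange (evalTable g t) (evalTable g t') (evalRows A r) (evalRows A r'))
      where g = contribIndependent src c A'

    decode-ε : ∀ src c A A' → decode src c A A' S.ε ≡ εS
    decode-ε src c A A' = trans (cong₂ _⊕M_ (evalTable-ε (contribIndependent src c A')) (evalRows-ε A)) (identityˡ εS)

    decode-fold : ∀ {B : Set} src c A A' (f : B → Sketch k) l →
                  decode src c A A' (ComMonoidOps.fold (sketchMonoid k) f l) ≡ fold (λ x → decode src c A A' (f x)) l
    decode-fold src c A A' f [] = decode-ε src c A A'
    decode-fold src c A A' f (x ∷ l) =
      trans (decode-⊕ src c A A' (f x) _) (cong (decode src c A A' (f x) ⊕M_) (decode-fold src c A A' f l))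

    evalRows-rowsFor : ∀ A v T → evalRows A (rowsFor v T) ≡ contribCover A v T
    evalRows-rowsFor A v T =
      trans (foldF-cong (λ j → cong (λ M → count0 , M , true)
                                    (trans (cong (mask (lookup A j)) (lookup-map j (λ x → mask (eqF x v) T) xs))
                                           (mask-mask (lookup A j) (eqF (lookup xs j) v) T))))
            (foldF-mask (λ j → eqF (lookup xs j) v ∧ lookup A j) T)

    decode-sketchOf : ∀ src c A A' v T → decode src c A A' (sketchOf v T) ≡ contrib src c A A' v T
    decode-sketchOf src c A A' v T with inCoverᵇ v
    ... | true = trans (cong (_⊕M evalRows A (rowsFor v T)) (evalTable-ε (contribIndependent src c A')))
                       (trans (identityˡ _) (evalRows-rowsFor A v T))
    ... | false = trans (cong₂ _⊕M_ (evalTable-singleton (contribIndependent src c A') T) (evalRows-ε A)) (identityʳ _)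

  module Machine1 {n k : ℕ} where
    State1 : Set
    State1 = Vec (Fin n) k × Sketch k × Pending n k

    step1 : State1 → Token n → State1
    step1 (xs , a , p) t = xs , VertexBlocks.readToken xs (sketchMonoid k) (Sketching.sketchOf xs) (a , p) t

    decodeSummary : Vec (Fin n) k → Sketch k → Instr k → MachineData k → Summary k
    decodeSummary xs S ins ((c , A , A' , f) , b) = Sketching.decode xs (sourceOf ins) c A A' S

    -- After the pass, the whole schedule is run offline on the decoded summaries.
    out1 : State1 → Maybe ℕ
    out1 (xs , a , p) =
      Interpreter.output xs (Interpreter.execute xs (decodeSummary xs (VertexBlocks.flush xs (sketchMonoid k) (Sketching.sketchOf xs) (a , p)))
                                                    (Interpreter.data0 xs) (schedule k))

    init1 : Vec (Fin n) k → State1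
    init1 xs = xs , (table0 , rows0) , nothing

  module Run1 {n k : ℕ} (G : Graph n) (xs : Vec (Fin n) k)
    (cover : ∀ u v → adj G u v ≡ true → InCover xs u ⊎ InCover xs v)
    (σ : List (Fin n)) (σp : σ ↭ allFin n)
    (nb : Fin n → List (Fin n)) (nbp : ∀ v → nb v ↭ nbrs G v) where
    open Contribution xs
    open Layers G xs cover
    open Diameter G xs cover
    open Interpreter xs
    open VertexBlocks xs (sketchMonoid k)
    open TypeAccumulation xs
    open Sketching xs
    open Machine1 {n} {k}
    open ComMonoidOps (summaryMonoid k)
    private module S = ComMonoid (sketchMonoid k)

    s : List (Token n)
    s = concatMap (vertexBlock nb) σ

    sketch : Sketch k
    sketch = flush sketchOf (foldl (readToken sketchOf) (S.ε , nothing) s)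

    sketch-fold : sketch ≡ ComMonoidOps.fold (sketchMonoid k) (λ v → sketchOf v (accum (nb v) zeros)) σ
    sketch-fold = trans (read-blocks sketchOf nb σ (S.ε , nothing)) (trans (cong (S._⊕ F) (S.identityˡ S.ε)) (S.identityˡ F))
      where F = ComMonoidOps.fold (sketchMonoid k) (λ v → sketchOf v (accum (nb v) zeros)) σ

    read-all : ∀ st (l : List (Token n)) → foldl step1 (xs , st) l ≡ (xs , foldl (readToken sketchOf) st l)
    read-all st [] = refl
    read-all st (t ∷ l) = read-all _ l

    decode-sketch : ∀ src c A A' → decode src c A A' sketch ≡ passSummary src c A A'
    decode-sketch src c A A' =
      trans (cong (decode src c A A') sketch-fold)
      (trans (decode-fold src c A A' (λ v → sketchOf v (accum (nb v) zeros)) σ)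
      (trans (fold-cong (λ v → trans (decode-sketchOf src c A A' v _) (cong (contrib src c A A' v) (accum-nbrs G v (nb v) (nbp v)))) σ)
      (trans (fold-↭ (λ v → contrib src c A A' v (typeOf v)) σp)
             (fold-tabulate (λ v → contrib src c A A' v (typeOf v)) (λ v → v)))))

    execute-cong : ∀ (O O' : Instr k → MachineData k → Summary k) → (∀ ins d → O ins d ≡ O' ins d) →
                   ∀ d L → execute O d L ≡ execute O' d L
    execute-cong O O' p d [] = refl
    execute-cong O O' p d (x ∷ L) rewrite p x d = execute-cong O O' p _ L

    out-eq : out1 (foldl step1 (init1 xs) s) ≡ output (execute exactSummary data0 (schedule k))
    out-eq rewrite read-all (S.ε , nothing) s =
      cong output (execute-cong (decodeSummary xs sketch) exactSummary
                     (λ { ins ((c , A , A' , f) , b) → decode-sketch (sourceOf ins) c A A' }) data0 (schedule k))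


module Codecs where

  open import Data.Bool using (Bool; true; false)
  open import Data.Nat using (ℕ; zero; suc; _+_; _*_; _^_; _≤_; _<_; z≤n; s≤s; _<?_; ⌈_/2⌉; ⌊_/2⌋; _∸_)
  open import Data.Nat.Properties
  open import Data.Nat.Logarithm using (⌈log₂_⌉; ⌈log₂⌉-mono-≤; ⌈log₂⌈n/2⌉⌉≡⌈log₂n⌉∸1; ⌈log₂2^n⌉≡n)
  open import Data.Nat.Induction using (<-rec)
  open import Data.Fin using (Fin; zero; suc; toℕ; fromℕ<)
  open import Data.Fin.Properties using (toℕ<n; fromℕ<-toℕ)
  open import Data.Vec using (Vec; []; _∷_; _++_)
  open import Data.Maybe using (Maybe; just; nothing)
  open import Data.Product using (_×_; _,_; proj₁; proj₂)
  open import Relation.Nullary using (yes; no; contradiction)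
  open import Relation.Binary.PropositionalEquality using (_≡_; refl; sym; trans; cong; cong₂; subst; subst₂)

  record Codec (A : Set) : Set where
    field
      size : ℕ
      enc : A → Vec Bool size
      dec : Vec Bool size → A
      dec-enc : ∀ a → dec (enc a) ≡ a
  open Codec public

  codecBool : Codec Bool
  codecBool = record { size = 1 ; enc = λ b → b ∷ [] ; dec = λ { (b ∷ []) → b } ; dec-enc = λ b → refl }

  split : ∀ {A : Set} m {n} → Vec A (m + n) → Vec A m × Vec A n
  split zero v = [] , v
  split (suc m) (x ∷ v) = (x ∷ proj₁ (split m v)) , proj₂ (split m v)

  split-++ : ∀ {A : Set} {m n} (u : Vec A m) (w : Vec A n) → split m (u ++ w) ≡ (u , w)
  split-++ [] w = refl
  split-++ (x ∷ u) w rewrite split-++ u w = refl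

  codec× : ∀ {A B : Set} → Codec A → Codec B → Codec (A × B)
  codec× ca cb = record
    { size = size ca + size cb
    ; enc = λ { (a , b) → enc ca a ++ enc cb b }
    ; dec = λ v → dec ca (proj₁ (split (size ca) v)) , dec cb (proj₂ (split (size ca) v))
    ; dec-enc = λ { (a , b) → cong₂ _,_ (trans (cong (λ z → dec ca (proj₁ z)) (split-++ (enc ca a) (enc cb b))) (dec-enc ca a))
                                         (trans (cong (λ z → dec cb (proj₂ z)) (split-++ (enc ca a) (enc cb b))) (dec-enc cb b)) }
    }

  codecVec : ∀ {A : Set} m → Codec A → Codec (Vec A m)
  codecVec {A} m ca = record { size = m * size ca ; enc = encVec m ; dec = decVec m ; dec-enc = dec-encVec m }
    where
      encVec : ∀ m → Vec A m → Vec Bool (m * size ca)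
      encVec zero [] = []
      encVec (suc m) (a ∷ as) = enc ca a ++ encVec m as
      decVec : ∀ m → Vec Bool (m * size ca) → Vec A m
      decVec zero v = []
      decVec (suc m) v = dec ca (proj₁ (split (size ca) v)) ∷ decVec m (proj₂ (split (size ca) v))
      dec-encVec : ∀ m (as : Vec A m) → decVec m (encVec m as) ≡ as
      dec-encVec zero [] = refl
      dec-encVec (suc m) (a ∷ as) rewrite split-++ (enc ca a) (encVec m as) | dec-enc ca a | dec-encVec m as = refl

  codecMaybe : ∀ {A : Set} → Codec A → A → Codec (Maybe A)
  codecMaybe ca a₀ = record
    { size = suc (size ca)
    ; enc = λ { nothing → false ∷ enc ca a₀ ; (just a) → true ∷ enc ca a }
    ; dec = λ { (false ∷ v) → nothing ; (true ∷ v) → just (dec ca v) }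
    ; dec-enc = λ { nothing → refl ; (just a) → cong just (dec-enc ca a) }
    }

  bit : Bool → ℕ
  bit true = 1
  bit false = 0

  half : ℕ → ℕ × Bool
  half zero = 0 , false
  half (suc zero) = 0 , true
  half (suc (suc x)) = suc (proj₁ (half x)) , proj₂ (half x)

  half-correct : ∀ x → x ≡ bit (proj₂ (half x)) + (proj₁ (half x) + proj₁ (half x))
  half-correct zero = refl
  half-correct (suc zero) = refl
  half-correct (suc (suc x)) = trans (cong (λ z → suc (suc z)) (half-correct x)) (shift (bit (proj₂ (half x))) (proj₁ (half x)))
    where
      shift : ∀ b q → suc (suc (b + (q + q))) ≡ b + (suc q + suc q)
      shift b q = trans (cong suc (sym (+-suc b (q + q)))) (trans (sym (+-suc b (suc (q + q)))) (cong (b +_) (cong suc (sym (+-suc q q)))))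

  toBits : ∀ L → ℕ → Vec Bool L
  toBits zero x = []
  toBits (suc L) x = proj₂ (half x) ∷ toBits L (proj₁ (half x))

  fromBits : ∀ {L} → Vec Bool L → ℕ
  fromBits [] = 0
  fromBits (b ∷ v) = bit b + (fromBits v + fromBits v)

  halve-< : ∀ b q P → b + (q + q) < P + P → q < P
  halve-< b q P lt with q <? P
  ... | yes q<P = q<P
  ... | no q≮P = contradiction (≤-<-trans (≤-trans (+-mono-≤ P≤q P≤q) (m≤n+m (q + q) b)) lt) (<-irrefl refl)
    where P≤q = ≮⇒≥ q≮P

  fromBits-toBits : ∀ L x → x < 2 ^ L → fromBits (toBits L x) ≡ x
  fromBits-toBits zero zero lt = refl
  fromBits-toBits zero (suc x) (s≤s ())
  fromBits-toBits (suc L) x lt =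
    trans (cong (λ z → bit (proj₂ (half x)) + (z + z)) (fromBits-toBits L (proj₁ (half x)) q<2^L)) (sym (half-correct x))
    where
      q<2^L : proj₁ (half x) < 2 ^ L
      q<2^L = halve-< (bit (proj₂ (half x))) _ (2 ^ L)
                (subst₂ _<_ (half-correct x) (cong (2 ^ L +_) (+-identityʳ (2 ^ L))) lt)

  -- Values that do not denote an element decode to zero.
  codecFin : ∀ N L → suc N ≤ 2 ^ L → Codec (Fin (suc N))
  codecFin N L fits = record { size = L ; enc = λ i → toBits L (toℕ i) ; dec = decFin ; dec-enc = dec-encFin }
    where
      decFin : Vec Bool L → Fin (suc N)
      decFin v with fromBits v <? suc N
      ... | yes p = fromℕ< p
      ... | no _ = zero
      fromℕ<-cong : ∀ {a b} (e : a ≡ b) (p : a < suc N) → fromℕ< p ≡ fromℕ< (subst (_< suc N) e p)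
      fromℕ<-cong refl p = refl
      dec-encFin : ∀ i → decFin (toBits L (toℕ i)) ≡ i
      dec-encFin i with fromBits (toBits L (toℕ i)) <? suc N | fromBits-toBits L (toℕ i) (<-≤-trans (toℕ<n i) fits)
      ... | yes p | e = trans (fromℕ<-cong e p) (fromℕ<-toℕ i (toℕ<n i))
      ... | no np | e = contradiction (subst (_< suc N) (sym e) (toℕ<n i)) np

  ≤-2^⌈log₂⌉ : ∀ n → n ≤ 2 ^ ⌈log₂ n ⌉
  ≤-2^⌈log₂⌉ = <-rec _ go
    where
      go : ∀ n → (∀ {m} → m < n → m ≤ 2 ^ ⌈log₂ m ⌉) → n ≤ 2 ^ ⌈log₂ n ⌉
      go zero rec = z≤n
      go (suc zero) rec = s≤s z≤n
      go (suc (suc n)) rec = begin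
          N                                   ≡⟨ sym (⌊n/2⌋+⌈n/2⌉≡n N) ⟩
          ⌊ N /2⌋ + h                         ≤⟨ +-monoˡ-≤ h (⌊n/2⌋≤⌈n/2⌉ N) ⟩
          h + h                               ≤⟨ +-mono-≤ (rec (⌈n/2⌉<n n)) (rec (⌈n/2⌉<n n)) ⟩
          2 ^ ⌈log₂ h ⌉ + 2 ^ ⌈log₂ h ⌉       ≡⟨ cong (λ z → 2 ^ z + 2 ^ z) (⌈log₂⌈n/2⌉⌉≡⌈log₂n⌉∸1 N) ⟩
          2 ^ (L ∸ 1) + 2 ^ (L ∸ 1)           ≡⟨ doubling L (subst (_≤ L) (⌈log₂2^n⌉≡n 1) (⌈log₂⌉-mono-≤ {2 ^ 1} {N} (s≤s (s≤s z≤n)))) ⟩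
          2 ^ L                               ∎
        where
          open ≤-Reasoning
          N = suc (suc n)
          h = ⌈ N /2⌉
          L = ⌈log₂ N ⌉
          doubling : ∀ L → 1 ≤ L → 2 ^ (L ∸ 1) + 2 ^ (L ∸ 1) ≡ 2 ^ L
          doubling (suc L) _ = cong (2 ^ L +_) (sym (+-identityʳ (2 ^ L)))


module Estimates where

  open import Data.Nat
  open import Data.Nat.Properties
  open import Data.Nat.Tactic.RingSolver using (solve-∀)
  open import Relation.Binary.PropositionalEquality using (_≡_; sym; trans; cong; subst)
  open ≤-Reasoning

  1≤2^k : ∀ k → 1 ≤ 2 ^ k
  1≤2^k k = m^n>0 2 k

  2^suc : ∀ k → 2 ^ suc k ≡ 2 ^ k + 2 ^ k
  2^suc k = cong (2 ^ k +_) (+-identityʳ (2 ^ k))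

  k≤2^k : ∀ k → k ≤ 2 ^ k
  k≤2^k zero = z≤n
  k≤2^k (suc k) = ≤-trans (+-mono-≤ (1≤2^k k) (k≤2^k k)) (≤-reflexive (sym (2^suc k)))

  2k+1≤2^k+2^k : ∀ k → suc (k + k) ≤ 2 ^ k + 2 ^ k
  2k+1≤2^k+2^k zero = s≤s z≤n
  2k+1≤2^k+2^k (suc k) = begin
    suc (suc k + suc k)                 ≡⟨ cong (λ z → suc (suc z)) (+-suc k k) ⟩
    2 + suc (k + k)                     ≤⟨ +-mono-≤ (+-mono-≤ (1≤2^k k) (1≤2^k k)) (2k+1≤2^k+2^k k) ⟩
    (2 ^ k + 2 ^ k) + (2 ^ k + 2 ^ k)   ≡⟨ cong (λ z → z + z) (sym (2^suc k)) ⟩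
    2 ^ suc k + 2 ^ suc k               ∎

  k*k≤2^k+2^k : ∀ k → k * k ≤ 2 ^ k + 2 ^ k
  k*k≤2^k+2^k zero = z≤n
  k*k≤2^k+2^k (suc k) = begin
    suc k * suc k                       ≡⟨ square k ⟩
    suc (k + k) + k * k                 ≤⟨ +-mono-≤ (2k+1≤2^k+2^k k) (k*k≤2^k+2^k k) ⟩
    (2 ^ k + 2 ^ k) + (2 ^ k + 2 ^ k)   ≡⟨ cong (λ z → z + z) (sym (2^suc k)) ⟩
    2 ^ suc k + 2 ^ suc k               ∎
    where
      square : ∀ k → suc k * suc k ≡ suc (k + k) + k * k
      square = solve-∀

  -- Width of the program counter and of the round numbers.
  counterBits : ℕ → ℕ
  counterBits k = 6 + (k + (k + k))

  schedule-length-bound : ∀ k → suc ((k + 2 ^ k) * (4 + (k + k))) ≤ 2 ^ counterBits k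
  schedule-length-bound k = begin
      suc ((k + P) * (4 + (k + k)))
    ≤⟨ s≤s (*-mono-≤ (+-monoˡ-≤ P (k≤2^k k)) (+-mono-≤ (*-monoʳ-≤ 4 (1≤2^k k)) (+-mono-≤ (k≤2^k k) (k≤2^k k)))) ⟩
      suc ((P + P) * (4 * P + (P + P)))
    ≡⟨ cong suc (twelve P) ⟩
      suc (12 * (P * P))
    ≤⟨ +-monoˡ-≤ (12 * (P * P)) (*-mono-≤ (1≤2^k k) (1≤2^k k)) ⟩
      13 * (P * P)
    ≤⟨ *-mono-≤ (m≤n+m 13 51) (subst (_≤ P * (P * P)) (*-identityˡ (P * P)) (*-monoˡ-≤ (P * P) (1≤2^k k))) ⟩
      64 * (P * (P * P))
    ≡⟨ sym (cube k) ⟩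
      2 ^ counterBits k ∎
    where
      P = 2 ^ k
      twelve : ∀ P → (P + P) * (4 * P + (P + P)) ≡ 12 * (P * P)
      twelve = solve-∀
      cube : ∀ k → 2 ^ counterBits k ≡ 64 * (2 ^ k * (2 ^ k * 2 ^ k))
      cube k = trans (^-distribˡ-+-* 2 6 (k + (k + k)))
                 (cong (64 *_) (trans (^-distribˡ-+-* 2 k (k + k)) (cong (2 ^ k *_) (^-distribˡ-+-* 2 k k))))

  rounds-bound : ∀ k → suc (suc (k + k)) ≤ 2 ^ counterBits k
  rounds-bound k = ≤-trans (s≤s (begin
      suc (k + k)                    ≤⟨ m≤n+m (suc (k + k)) 3 ⟩
      4 + (k + k)                    ≡⟨ sym (*-identityˡ _) ⟩
      1 * (4 + (k + k))              ≤⟨ *-monoˡ-≤ (4 + (k + k)) (≤-trans (1≤2^k k) (m≤n+m (2 ^ k) k)) ⟩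
      (k + 2 ^ k) * (4 + (k + k))    ∎))
    (schedule-length-bound k)

  passes-bound : ∀ k → (suc k + 2 ^ suc k) * (4 + (suc k + suc k)) ≤ 50 * (2 ^ suc k * suc k) + 50
  passes-bound k = begin
      (K + P) * (4 + (K + K))
    ≤⟨ *-mono-≤ (+-monoˡ-≤ P (k≤2^k K)) (+-monoˡ-≤ (K + K) (*-monoʳ-≤ 4 (s≤s (z≤n {k})))) ⟩
      (P + P) * (4 * K + (K + K))
    ≡⟨ twelve P K ⟩
      12 * (P * K)
    ≤⟨ *-monoˡ-≤ (P * K) (m≤m+n 12 38) ⟩
      50 * (P * K)
    ≤⟨ m≤m+n _ 50 ⟩
      50 * (P * K) + 50 ∎
    where
      P = 2 ^ suc k
      K = suc k
      twelve : ∀ P K → (P + P) * (4 * K + (K + K)) ≡ 12 * (P * K)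
      twelve = solve-∀


module Algorithms where

  open import Defs hiding (sym)
  open Monoids
  open Contributions
  open LayerSearch
  open Schedule
  open ScheduleCorrect
  open StreamFolds
  open MultiPass
  open TypeTables
  open OnePass
  open CoverList
  open Codecs
  open Estimates
  open import Data.Nat.Logarithm using (⌈log₂_⌉; ⌈log₂2^n⌉≡n; ⌈log₂⌉-mono-≤)
  open import Data.Nat.Tactic.RingSolver using (solve-∀)
  open import Data.Bool using (Bool; true; false)
  open import Data.Nat using (ℕ; zero; suc; pred; _+_; _*_; _^_; _≤_; z≤n; s≤s)
  open import Data.Nat.Properties using (≤-refl; ≤-trans; +-mono-≤; m≤m+n; ≤-reflexive; *-identityʳ; +-identityʳ; +-comm)
  open import Data.Fin using (Fin; zero; suc; toℕ)
  open import Data.Fin.Subset using (Subset; ∣_∣)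
  open import Data.List using (List; []; _∷_; map; concatMap; foldl; allFin; length)
  open import Data.List.Properties using (length-++; length-map; length-tabulate)
  open import Data.List.Relation.Binary.Permutation.Propositional using (_↭_; ↭-sym)
  open import Data.List.Relation.Binary.Permutation.Propositional.Properties using (∈-resp-↭)
  open import Data.List.Membership.Propositional.Properties using (∈-allFin)
  open import Data.Vec using (Vec)
  open import Data.Maybe using (Maybe; just; nothing)
  open import Data.Product using (_,_; proj₁; proj₂)
  open import Data.Sum using (_⊎_; inj₁; inj₂)
  open import Relation.Nullary using (¬_; contradiction)
  open import Relation.Binary.PropositionalEquality using (_≡_; refl; sym; trans; cong; cong₂; subst)

  module _ {n : ℕ} {S O : Set} (c : Codec S) (i : Subset n → S) (st : S → Token n → S) (o : S → O) where
    encoded : StreamAlg n (size c) O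
    encoded = record { init = λ X → enc c (i X) ; next = λ m t → enc c (st (dec c m) t) ; out = λ m → o (dec c m) }

    foldl-encoded : ∀ s x → foldl (next encoded) (enc c x) s ≡ enc c (foldl st x s)
    foldl-encoded [] x = refl
    foldl-encoded (t ∷ s) x rewrite dec-enc c x = foldl-encoded s (st x t)

    passes-encoded : ∀ p x s → passes (next encoded) p (enc c x) s ≡ enc c (passesOn st p x s)
    passes-encoded zero x s = refl
    passes-encoded (suc p) x s rewrite foldl-encoded s x = passes-encoded p (foldl st x s) s

    run-encoded : ∀ p X s → run encoded p X s ≡ o (passesOn st p (i X) s)
    run-encoded p X s rewrite passes-encoded p (i X) s = cong o (dec-enc c _)

  length-allVecs : ∀ m → length (allVecs m) ≡ 2 ^ m
  length-allVecs zero = refl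
  length-allVecs (suc m)
    rewrite length-++ (map (false Vec.∷_) (allVecs m)) {map (true Vec.∷_) (allVecs m)}
          | length-map (false Vec.∷_) (allVecs m) | length-map (true Vec.∷_) (allVecs m) | length-allVecs m
          = cong (2 ^ m +_) (sym (+-identityʳ (2 ^ m)))
    where import Data.Vec as Vec

  length-block : ∀ {k} (src : Source k) → length (block src) ≡ 4 + (k + k)
  length-block {k} src =
    cong suc (trans (length-++ (map (roundI src) (allFin (suc (maxEccentricity k)))) {finishI src ∷ []})
               (trans (cong (_+ 1) (trans (length-map (roundI src) (allFin (suc (maxEccentricity k))))
                                          (length-tabulate {n = suc (maxEccentricity k)} (λ i → i))))
                      (+-comm (suc (suc (k + k))) 1)))

  length-schedule : ∀ k → length (schedule k) ≡ (k + 2 ^ k) * (4 + (k + k))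
  length-schedule k = trans (blocks (sources k)) (cong (_* (4 + (k + k))) length-sources)
    where
      blocks : ∀ (l : List (Source k)) → length (concatMap block l) ≡ length l * (4 + (k + k))
      blocks [] = refl
      blocks (x ∷ l) = trans (length-++ (block x) {concatMap block l}) (cong₂ _+_ (length-block x) (blocks l))
      length-sources : length (sources k) ≡ k + 2 ^ k
      length-sources
        rewrite length-++ (map fromCover (allFin k)) {map fromType (allVecs k)} | length-map fromCover (allFin k)
              | length-map fromType (allVecs k) | length-tabulate {n = k} (λ i → i) | length-allVecs k = refl

  isFinite : Maybe ℕ → Bool
  isFinite (just _) = true
  isFinite nothing = false

  connectivity-from-diameter : ∀ {n} (G : Graph n) o → IsDiameter G o → ConnectivityCorrect G (isFinite o)
  connectivity-from-diameter G nothing (s , t , unreachable) = (λ ()) , (λ connected → contradiction (connected s t) unreachable)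
  connectivity-from-diameter G (just D) (bounded , _) =
    (λ _ s t → proj₁ (bounded s t) , proj₁ (proj₂ (proj₂ (bounded s t)))) , (λ _ → refl)

  connectivity-solvable : ∀ {n k p m} → Solvable (Maybe ℕ) DiameterCorrect n k p m → Solvable Bool ConnectivityCorrect n k p m
  connectivity-solvable (A , correct) =
    record { init = init A ; next = next A ; out = λ st → isFinite (out A st) } ,
    λ G X e vc s als → connectivity-from-diameter G _ (correct G X e vc s als)

  codecCount : Codec Count
  codecCount = codec× codecBool codecBool

  codecBits : ∀ k → Codec (Vec Bool k)
  codecBits k = codecVec k codecBool

  codecRound : ∀ k → Codec (Round k)
  codecRound k = codecFin (maxEccentricity k) (counterBits k) (rounds-bound k)

  codecSummary : ∀ k → Codec (Summary k)
  codecSummary k = codec× codecCount (codec× (codecBits k) codecBool)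

  codecMachineData : ∀ k → Codec (MachineData k)
  codecMachineData k =
    codec× (codec× codecCount (codec× (codecBits k) (codec× (codecBits k) (codecMaybe (codecRound k) zero))))
           (codecMaybe (codecRound k) zero)

  codecCounter : ∀ k → Codec (Fin (suc (length (schedule k))))
  codecCounter k = codecFin (length (schedule k)) (counterBits k)
                     (subst (λ z → suc z ≤ 2 ^ counterBits k) (sym (length-schedule k)) (schedule-length-bound k))

  codecVertex : ∀ n' → Codec (Fin (suc n'))
  codecVertex n' = codecFin n' ⌈log₂ suc n' ⌉ (≤-2^⌈log₂⌉ (suc n'))

  codecPending : ∀ n' k → Codec (Pending (suc n') k)
  codecPending n' k = codecMaybe (codec× (codecVertex n') (codecBits k)) (zero , zeros)

  codecState : ∀ n' k → Codec (Machine.State {suc n'} {k})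
  codecState n' k =
    codec× (codecVec k (codecVertex n'))
      (codec× (codecMaybe (codecVertex n') zero)
        (codec× (codec× (codecCounter k) (codecMachineData k)) (codec× (codecSummary k) (codecPending n' k))))

  codecTable : ∀ d → Codec (Table d)
  codecTable zero = codecCount
  codecTable (suc d) = codec× (codecTable d) (codecTable d)

  codecState1 : ∀ n' k → Codec (Machine1.State1 {suc n'} {k})
  codecState1 n' k = codec× (codecVec k (codecVertex n')) (codec× (codec× (codecTable k) (codecVec k (codecBits k))) (codecPending n' k))

  module Construction (n' k : ℕ) where
    n = suc n'
    open Machine {n} {k}
    open Machine1 {n} {k}

    -- The stored cover; vertex zero pads it when ∣ X ∣ ≢ k.
    coverOf : Subset n → Vec (Fin n) k
    coverOf X = coverVector k zero X

    -- Written as a successor so that the first pass (which only finds the first vertex)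
    -- can be separated from the others.
    passCount : ℕ
    passCount = suc (pred (length (schedule k)))

    passCount≡ : passCount ≡ length (schedule k)
    passCount≡ with length (schedule k) | length-schedule k
    ... | suc _ | _ = refl
    ... | zero | e = contradiction (trans e (cong (_* (4 + (k + k))) (+-comm k (2 ^ k)))) (positive (2 ^ k) (1≤2^k k))
      where
        positive : ∀ P → 1 ≤ P → ¬ (0 ≡ (P + k) * (4 + (k + k)))
        positive (suc P) _ ()

    multiPass : StreamAlg n (size (codecState n' k)) (Maybe ℕ)
    multiPass = encoded (codecState n' k) (λ X → initM (coverOf X)) stepM outM

    onePass : StreamAlg n (size (codecState1 n' k)) (Maybe ℕ)
    onePass = encoded (codecState1 n' k) (λ X → init1 (coverOf X)) step1 out1

    module Correct (G : Graph n) (X : Subset n) (∣X∣≡k : ∣ X ∣ ≡ k) (vc : IsVertexCover G X)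
                   (s : List (Token n)) (als : ALStream G s) where
      xs = coverOf X

      cover : ∀ u v → adj G u v ≡ true → InCover xs u ⊎ InCover xs v
      cover u v e with vc u v e
      ... | inj₁ m = inj₁ (coverVector-complete zero X ∣X∣≡k m)
      ... | inj₂ m = inj₂ (coverVector-complete zero X ∣X∣≡k m)

      open Diameter G xs cover
      open Interpreter xs

      σ = proj₁ als
      σp = proj₁ (proj₂ als)
      nb = proj₁ (proj₂ (proj₂ als))
      nbp = proj₁ (proj₂ (proj₂ (proj₂ als)))
      s≡ = proj₂ (proj₂ (proj₂ (proj₂ als)))

      exact-diameter : IsDiameter G (output (execute exactSummary data0 (schedule k)))
      exact-diameter = subst (λ z → IsDiameter G (Data.Maybe.map toℕ z)) (sym result-eq) (result-diameter zero)

      multiPass-output : outM (passesOn stepM passCount (initM xs) s) ≡ output (execute exactSummary data0 (schedule k))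
      multiPass-output = go σ σp s≡
        where
          go : ∀ σ' → σ' ↭ allFin n → s ≡ concatMap (λ v → vtx v ∷ map (edge v) (nb v)) σ' →
               outM (passesOn stepM passCount (initM xs) s) ≡ output (execute exactSummary data0 (schedule k))
          go [] σp' e with ∈-resp-↭ (↭-sym σp') (∈-allFin {suc n'} zero)
          ... | ()
          go (σ₀ ∷ rest) σp' e =
            subst (λ z → outM (passesOn stepM passCount (initM xs) z) ≡ output (execute exactSummary data0 (schedule k))) (sym e)
              (trans (R.output-after (pred (length (schedule k))))
                (trans (cong (λ z → output (proj₂ (R.iterate z (zero , data0)))) passCount≡)
                       (cong output (R.iterate-schedule [] (schedule k) zero data0 refl refl))))
            where module R = Run G xs cover σ₀ rest σp' nb nbp

      onePass-output : out1 (passesOn step1 1 (init1 xs) s) ≡ output (execute exactSummary data0 (schedule k))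
      onePass-output =
        subst (λ z → out1 (passesOn step1 1 (init1 xs) z) ≡ output (execute exactSummary data0 (schedule k))) (sym s≡)
          (Run1.out-eq G xs cover σ σp nb nbp)

    multiPass-solves : Solvable (Maybe ℕ) DiameterCorrect n k passCount (size (codecState n' k))
    multiPass-solves = multiPass , λ G X e vc s als →
      subst (IsDiameter G)
        (sym (trans (run-encoded (codecState n' k) (λ X → initM (coverOf X)) stepM outM passCount X s) (Correct.multiPass-output G X e vc s als)))
        (Correct.exact-diameter G X e vc s als)

    onePass-solves : Solvable (Maybe ℕ) DiameterCorrect n k 1 (size (codecState1 n' k))
    onePass-solves = onePass , λ G X e vc s als →
      subst (IsDiameter G)
        (sym (trans (run-encoded (codecState1 n' k) (λ X → init1 (coverOf X)) step1 out1 1 X s) (Correct.onePass-output G X e vc s als)))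
        (Correct.exact-diameter G X e vc s als)

    passCount-bound : ∀ a → k ≡ suc a → passCount ≤ 50 * (2 ^ k * k) + 50
    passCount-bound a refl = subst (_≤ 50 * (2 ^ k * k) + 50) (sym (trans passCount≡ (length-schedule k))) (passes-bound a)

  size-codecState : ∀ n' k → size (codecState n' k) ≡
    k * ⌈log₂ suc n' ⌉ + (suc ⌈log₂ suc n' ⌉ + ((counterBits k + ((2 + (k * 1 + (k * 1 + suc (counterBits k)))) + suc (counterBits k)))
      + ((2 + (k * 1 + 1)) + suc (⌈log₂ suc n' ⌉ + k * 1))))
  size-codecState n' k = refl

  multiPass-memory : ∀ n' k → 1 ≤ k → k ≤ suc n' → size (codecState n' k) ≤ 50 * (k * ⌈log₂ suc n' ⌉) + 50
  multiPass-memory n' k 1≤k k≤n =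
    subst (_≤ 50 * (k * L) + 50) (sym (trans (size-codecState n' k) (polynomial k L))) (bound k L 1≤k (k≡1-or-1≤L k 1≤k k≤n))
    where
      L = ⌈log₂ suc n' ⌉
      polynomial : ∀ k L → k * L + (suc L + (((6 + (k + (k + k))) + ((2 + (k * 1 + (k * 1 + suc (6 + (k + (k + k)))))) + suc (6 + (k + (k + k)))))
                            + ((2 + (k * 1 + 1)) + suc (L + k * 1)))) ≡ k * L + 2 * L + 13 * k + 27
      polynomial = solve-∀
      -- When k ≥ 2 there are at least two vertices, so L ≥ 1.
      k≡1-or-1≤L : ∀ k → 1 ≤ k → k ≤ suc n' → (k ≡ 1 ⊎ 1 ≤ L)
      k≡1-or-1≤L (suc zero) _ _ = inj₁ refl
      k≡1-or-1≤L (suc (suc k)) _ (s≤s le) =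
        inj₂ (subst (_≤ L) (⌈log₂2^n⌉≡n 1) (⌈log₂⌉-mono-≤ {2 ^ 1} {suc n'} (s≤s (≤-trans (s≤s z≤n) le))))
      bound : ∀ k L → 1 ≤ k → (k ≡ 1 ⊎ 1 ≤ L) → k * L + 2 * L + 13 * k + 27 ≤ 50 * (k * L) + 50
      bound .1 L _ (inj₁ refl) = subst (1 * L + 2 * L + 13 * 1 + 27 ≤_) (slack L) (m≤m+n _ (47 * L + 10))
        where
          slack : ∀ L → 1 * L + 2 * L + 13 * 1 + 27 + (47 * L + 10) ≡ 50 * (1 * L) + 50
          slack = solve-∀
      bound (suc a) (suc b) _ (inj₂ (s≤s _)) = subst (suc a * suc b + 2 * suc b + 13 * suc a + 27 ≤_) (slack a b)
                                                 (m≤m+n _ (57 + 36 * a + 47 * b + 49 * (a * b)))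
        where
          slack : ∀ a b → suc a * suc b + 2 * suc b + 13 * suc a + 27 + (57 + 36 * a + 47 * b + 49 * (a * b)) ≡ 50 * (suc a * suc b) + 50
          slack = solve-∀

  size-codecTable : ∀ d → size (codecTable d) ≡ 2 ^ d + 2 ^ d
  size-codecTable zero = refl
  size-codecTable (suc d) rewrite size-codecTable d = cong (λ z → z + z) (sym (2^suc d))

  onePass-memory : ∀ n' a → size (codecState1 n' (suc a)) ≤ 50 * (2 ^ suc a + suc a * ⌈log₂ suc n' ⌉) + 50
  onePass-memory n' a = ≤-trans components (slack X P)
    where
      k = suc a
      L = ⌈log₂ suc n' ⌉
      P = 2 ^ k
      X = k * L
      components : k * L + ((size (codecTable k) + k * (k * 1)) + suc (L + k * 1)) ≤ X + (((P + P) + (P + P)) + suc (X + P))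
      components = +-mono-≤ (≤-refl {X})
        (+-mono-≤ (+-mono-≤ (≤-reflexive (size-codecTable k)) (subst (_≤ P + P) (cong (k *_) (sym (*-identityʳ k))) (k*k≤2^k+2^k k)))
                  (s≤s (+-mono-≤ (m≤m+n L (a * L)) (subst (_≤ P) (sym (*-identityʳ k)) (k≤2^k k)))))
      slack : ∀ X P → X + (((P + P) + (P + P)) + suc (X + P)) ≤ 50 * (P + X) + 50
      slack X P = subst (X + (((P + P) + (P + P)) + suc (X + P)) ≤_) (identity X P) (m≤m+n _ (45 * P + 48 * X + 49))
        where
          identity : ∀ X P → X + (((P + P) + (P + P)) + suc (X + P)) + (45 * P + 48 * X + 49) ≡ 50 * (P + X) + 50
          identity = solve-∀


module SmallCases where

  open import Defs hiding (sym)
  open import Data.Bool using (Bool; true)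
  open import Data.Nat using (ℕ; zero; suc; _≤_; _<_; z≤n)
  open import Data.Fin using (zero; suc)
  open import Data.Fin.Subset using (Subset; _∉_; _-_; ∣_∣)
  open import Data.Fin.Subset.Properties using (x∈p⇒∣p-x∣<∣p∣; ∣p∣≤n)
  open import Data.Vec using ([])
  open import Data.Maybe using (Maybe; just; nothing)
  open import Data.Sum using (inj₁; inj₂)
  open import Data.Product using (_,_)
  open import Relation.Nullary using (¬_; contradiction)
  open import Relation.Binary.PropositionalEquality using (_≡_; refl; subst)

  solvable-constant : ∀ {O : Set} (Correct : ∀ {n} → Graph n → O → Set) n k p (o : O) →
    (∀ (G : Graph n) (X : Subset n) → ∣ X ∣ ≡ k → IsVertexCover G X → Correct G o) → Solvable O Correct n k p 0
  solvable-constant Correct n k p o ok =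
    record { init = λ _ → [] ; next = λ _ _ → [] ; out = λ _ → o } , λ G X e vc s _ → ok G X e vc

  ∉-empty : ∀ {n} (X : Subset n) → ∣ X ∣ ≡ 0 → ∀ {u} → u ∉ X
  ∉-empty X e {u} u∈X = contradiction (subst (∣ X - u ∣ <_) e (x∈p⇒∣p-x∣<∣p∣ u∈X)) (λ ())

  walk-edgeless : ∀ {n} (G : Graph n) (X : Subset n) → ∣ X ∣ ≡ 0 → IsVertexCover G X →
                  ∀ {s t ℓ} → Walk G s t ℓ → s ≡ t
  walk-edgeless G X e vc here = refl
  walk-edgeless G X e vc (step {s} {u} a _) with vc s u a
  ... | inj₁ s∈X = contradiction s∈X (∉-empty X e)
  ... | inj₂ u∈X = contradiction u∈X (∉-empty X e)

  edgelessDiameter : ℕ → Maybe ℕ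
  edgelessDiameter zero = just 0
  edgelessDiameter (suc _) = nothing

  edgelessDiameter-correct : ∀ n' (G : Graph (suc n')) (X : Subset (suc n')) → ∣ X ∣ ≡ 0 → IsVertexCover G X →
                             IsDiameter G (edgelessDiameter n')
  edgelessDiameter-correct zero G X e vc =
    (λ { zero zero → 0 , z≤n , here , (λ _ _ → z≤n) }) , zero , zero , here , (λ _ _ → z≤n)
  edgelessDiameter-correct (suc n') G X e vc =
    zero , suc zero , λ { (ℓ , w) → contradiction (walk-edgeless G X e vc w) (λ ()) }

  no-large-cover : ∀ {n k} → ¬ k ≤ n → (X : Subset n) → ¬ ∣ X ∣ ≡ k
  no-large-cover k≰n X refl = k≰n (∣p∣≤n X)


open Algorithms
open SmallCases
open import Defs
open import Data.Bool using (Bool; true)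
open import Data.Nat using (ℕ; zero; suc; _+_; _*_; _^_; _≤_; _≤?_; z≤n; s≤s)
open import Data.Nat.Logarithm using (⌈log₂_⌉)
open import Data.Maybe using (Maybe; nothing)
open import Data.Product using (Σ; _×_; _,_)
open import Relation.Nullary using (yes; no; contradiction)
open import Relation.Binary.PropositionalEquality using (refl)

diameter-multipass : ∀ n k → 1 ≤ n → Σ ℕ λ p → Σ ℕ λ m →
  p ≤ 50 * (2 ^ k * k) + 50 × m ≤ 50 * (k * ⌈log₂ n ⌉) + 50 × Solvable (Maybe ℕ) DiameterCorrect n k p m
diameter-multipass (suc n') zero _ =
  0 , 0 , z≤n , z≤n , solvable-constant DiameterCorrect _ 0 0 _ (edgelessDiameter-correct n')
diameter-multipass (suc n') (suc a) _ with suc a ≤? suc n'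
... | yes k≤n = passCount , _ , passCount-bound a refl , multiPass-memory n' (suc a) (s≤s z≤n) k≤n , multiPass-solves
  where open Construction n' (suc a)
... | no k≰n = 0 , 0 , z≤n , z≤n ,
  solvable-constant DiameterCorrect _ _ 0 nothing (λ G X e _ → contradiction e (no-large-cover k≰n X))

diameter-onepass : ∀ n k → 1 ≤ n → Σ ℕ λ m →
  m ≤ 50 * (2 ^ k + k * ⌈log₂ n ⌉) + 50 × Solvable (Maybe ℕ) DiameterCorrect n k 1 m
diameter-onepass (suc n') zero _ = 0 , z≤n , solvable-constant DiameterCorrect _ 0 1 _ (edgelessDiameter-correct n')
diameter-onepass (suc n') (suc a) _ = _ , onePass-memory n' a , Construction.onePass-solves n' (suc a)

connectivity-multipass : ∀ n k → Σ ℕ λ p → Σ ℕ λ m →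
  p ≤ 50 * (2 ^ k * k) + 50 × m ≤ 50 * (k * ⌈log₂ n ⌉) + 50 × Solvable Bool ConnectivityCorrect n k p m
connectivity-multipass zero k =
  0 , 0 , z≤n , z≤n , solvable-constant ConnectivityCorrect 0 k 0 true (λ _ _ _ _ → (λ _ ()) , (λ _ → refl))
connectivity-multipass (suc n') k with diameter-multipass (suc n') k (s≤s z≤n)
... | p , m , p≤ , m≤ , solves = p , m , p≤ , m≤ , connectivity-solvable {p = p} solves

connectivity-onepass : ∀ n k → Σ ℕ λ m →
  m ≤ 50 * (2 ^ k + k * ⌈log₂ n ⌉) + 50 × Solvable Bool ConnectivityCorrect n k 1 m
connectivity-onepass zero k =
  0 , z≤n , solvable-constant ConnectivityCorrect 0 k 1 true (λ _ _ _ _ → (λ _ ()) , (λ _ → refl))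
connectivity-onepass (suc n') k with diameter-onepass (suc n') k (s≤s z≤n)
... | m , m≤ , solves = m , m≤ , connectivity-solvable {p = 1} solves

theorem1 :
    Σ ℕ λ c → ∀ n k →
      ((1 ≤ n → Σ ℕ λ p → Σ ℕ λ m →
          p ≤ c * (2 ^ k * k) + c × m ≤ c * (k * ⌈log₂ n ⌉) + c ×
          Solvable (Maybe ℕ) DiameterCorrect n k p m) ×
       (1 ≤ n → Σ ℕ λ m →
          m ≤ c * (2 ^ k + k * ⌈log₂ n ⌉) + c ×
          Solvable (Maybe ℕ) DiameterCorrect n k 1 m)) ×
      ((Σ ℕ λ p → Σ ℕ λ m →
          p ≤ c * (2 ^ k * k) + c × m ≤ c * (k * ⌈log₂ n ⌉) + c ×
          Solvable Bool ConnectivityCorrect n k p m) ×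
       (Σ ℕ λ m →
          m ≤ c * (2 ^ k + k * ⌈log₂ n ⌉) + c ×
          Solvable Bool ConnectivityCorrect n k 1 m))
theorem1 = 50 , λ n k → (diameter-multipass n k , diameter-onepass n k) , (connectivity-multipass n k , connectivity-onepass n k)
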